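{- Let $p$ be an odd prime, $t\ge 1$, and $a$ an integer not divisible by $p$. If $\left(\frac{a}{p}\right)=-1$, then $\#S_2''(a;p^t)=0$ and consequently $\#\bar{S}_2(a;p^t)=\frac{\phi(p^t)}{2}$. If $\left(\frac{a}{p}\right)=1$, then $$\#S_2''(a;p^t)=\frac{p^{t-1}}{p+1}+\frac{3}{2}+\frac{(-1)^{t-1}(p-1)}{2(p+1)}.$$
   Context: $S_2''(a;p^t)=\{k \bmod p^t: k^2-a \text{ is a square} \bmod p^t \text{ and } p\mid (k^2-a)\}$, where $c$ is a square modulo $N$ if $c\equiv x^2\bmod N$ for some integer $x$. For $n\ge2$ and $a$ coprime to $n$, $H_2(a;n)=\{(x,y)\in\mathbb{Z}^2: xy\equiv a \bmod n,\ 1\le x,y<n\}$ and $\bar{S}_2(a;n)=\{x+y \bmod n:(x,y)\in H_2(a;n)\}$. $\phi$ is Euler's totient function and $\left(\frac{a}{p}\right)$ is the Legendre symbol. -}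

module Defs where

open import Data.Bool.Base using (Bool; true; false; if_then_else_)
open import Data.Nat.Base as ℕ using (ℕ; suc; _<_; _≤_)
open import Data.Nat.Divisibility using (_∣?_)
open import Data.Nat.Coprimality using (coprime?)
open import Data.Integer.Base as ℤ using (ℤ; +_; -[1+_]; ∣_∣)
open import Data.Integer.Divisibility using () renaming (_∣_ to _∣ℤ_)
open import Data.List.Base using (List; length; upTo; map; filter)
open import Data.Bool.ListAction using (any)
open import Data.List.Relation.Unary.Unique.Propositional using (Unique)
open import Data.List.Membership.Propositional using (_∈_)
open import Data.Product.Base using (_×_; ∃)
open import Function.Bundles using (_⇔_)
open import Relation.Nullary.Decidable.Core using (⌊_⌋)
open import Relation.Binary.PropositionalEquality using (_≡_)

IsSquareMod : ℕ → ℤ → Set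
IsSquareMod N c = ∃ λ (x : ℤ) → (+ N) ∣ℤ (x ℤ.* x ℤ.- c)

legendre : ℤ → ℕ → ℤ
legendre a p =
  if ⌊ p ∣? ∣ a ∣ ⌋ then + 0
  else if any (λ x → ⌊ p ∣? ∣ (+ x) ℤ.* (+ x) ℤ.- a ∣ ⌋) (upTo p) then + 1
  else -[1+ 0 ]

φ : ℕ → ℕ
φ n = length (filter (λ k → coprime? k n) (map suc (upTo n)))

-- HasSize n P m : the set {k ∈ ℕ : k < n and P k} (residues mod n, represented
-- by 0,…,n-1) has exactly m elements.
HasSize : ℕ → (ℕ → Set) → ℕ → Set
HasSize n P m = ∃ λ (xs : List ℕ) →
  Unique xs × length xs ≡ m × (∀ k → (k ∈ xs) ⇔ (k < n × P k))

S₂'' : ℤ → ℕ → ℕ → ℕ → Set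
S₂'' a p N k = IsSquareMod N ((+ k) ℤ.* (+ k) ℤ.- a) × ((+ p) ∣ℤ ((+ k) ℤ.* (+ k) ℤ.- a))

S̄₂ : ℤ → ℕ → ℕ → Set
S̄₂ a n s = ∃ λ (x : ℕ) → ∃ λ (y : ℕ) →
  (1 ≤ x × x < n) × (1 ≤ y × y < n) ×
  ((+ n) ∣ℤ ((+ x) ℤ.* (+ y) ℤ.- a)) × ((+ n) ∣ℤ ((+ x) ℤ.+ (+ y) ℤ.- (+ s)))

{-# OPTIONS --safe #-}
-- Write p = 2h + 1 and N = p^t. By Hensel's lemma, whether a unit is a square mod N depends only on
-- its residue mod p, so exactly half of the units mod N are squares.
--
-- If (a/p) = 1, fix b with b² ≡ a (mod N). The shift k = b + j turns k² − a into j(j + 2b); as p ∤ 2b,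
-- p divides exactly one of j and j + 2b, and shifting j by −2b exchanges the two cases. Both halves
-- therefore count the j with p ∣ j and j(j + e) a square mod N, for a unit e. For such j = p i, the
-- valuation of j(j + e) is odd unless p ∣ i, and j = p² i reduces the count from level t to level t − 2
-- (the coefficient of j² becoming p²), where the i prime to p contribute half of the units mod p^(t−2).
-- Hence κ t = κ (t − 2) + p^(t−3)(p − 1)/2 for t ≥ 3 and κ 0 = κ 1 = κ 2 = 1, and #S₂'' = 2 κ t is
-- the stated closed form.
--
-- If (a/p) = −1, then p never divides k² − a. Moreover x + y ≡ s, x y ≡ a is solvable iff s² − 4a is
-- a square mod N, and mod p such s are the midpoints (w + 4a/w)/2 of the unordered pairs {w, 4a/w} of
-- units, which are never singletons because 4a is not a square. This gives (p − 1)/2 residues mod p,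
-- and Hensel's lemma lifts them to p^(t−1)(p − 1)/2 = φ(N)/2 residues mod N.

module Submission where

module Counting where

  open import Data.Nat.Base
  open import Data.Nat.Properties
  open import Data.Product.Base using (_×_; _,_; proj₁; proj₂; ∃)
  open import Data.Sum.Base using (_⊎_; inj₁; inj₂; [_,_]′)
  open import Data.Empty using (⊥-elim)
  open import Data.List.Base using (List; []; _∷_; length; upTo; map; filter; _++_)
  open import Data.List.Properties using (upTo-∷ʳ; filter-++; length-++)
  open import Data.List.Membership.Propositional.Properties using (∈-filter⁺; ∈-filter⁻; ∈-upTo⁺; ∈-upTo⁻)
  open import Data.List.Relation.Unary.Unique.Propositional.Properties using (upTo⁺; filter⁺)
  open import Relation.Nullary using (Dec; yes; no; ¬_)
  open import Relation.Nullary.Decidable using (_×-dec_; ¬?)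
  open import Relation.Unary using (Decidable)
  open import Relation.Binary.PropositionalEquality
  open import Function.Base using (_∘_)
  open import Defs using (HasSize)
  open import Function.Bundles using (_⇔_; mk⇔; module Equivalence)
  open import Algebra.Properties.CommutativeSemigroup +-commutativeSemigroup using (interchange)

  indicator : {A : Set} → Dec A → ℕ
  indicator (yes _) = 1
  indicator (no _)  = 0

  indicator-cong : {A B : Set} (a : Dec A) (b : Dec B) → (A → B) → (B → A) → indicator a ≡ indicator b
  indicator-cong (yes _) (yes _) f g = refl
  indicator-cong (yes x) (no y)  f g = ⊥-elim (y (f x))
  indicator-cong (no x)  (yes y) f g = ⊥-elim (x (g y))
  indicator-cong (no _)  (no _)  f g = refl

  indicator-no : {A : Set} (a : Dec A) → ¬ A → indicator a ≡ 0
  indicator-no (yes x) ¬x = ⊥-elim (¬x x)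
  indicator-no (no _)  ¬x = refl

  indicator-yes : {A : Set} (a : Dec A) → A → indicator a ≡ 1
  indicator-yes (yes _) x = refl
  indicator-yes (no ¬x) x = ⊥-elim (¬x x)

  count : {P : ℕ → Set} → Decidable P → ℕ → ℕ
  count P? zero    = 0
  count P? (suc n) = count P? n + indicator (P? n)

  module _ {P : ℕ → Set} (P? : Decidable P) where

    count-none : ∀ n → (∀ k → k < n → ¬ P k) → count P? n ≡ 0
    count-none zero    ¬P = refl
    count-none (suc n) ¬P = begin
      count P? n + indicator (P? n) ≡⟨ cong₂ _+_ (count-none n (λ k k<n → ¬P k (m<n⇒m<1+n k<n)))
                                                   (indicator-no (P? n) (¬P n ≤-refl)) ⟩
      0                             ∎
      where open ≡-Reasoning

    count-all : ∀ n → (∀ k → k < n → P k) → count P? n ≡ n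
    count-all zero    all = refl
    count-all (suc n) all = begin
      count P? n + indicator (P? n) ≡⟨ cong₂ _+_ (count-all n (λ k k<n → all k (m<n⇒m<1+n k<n)))
                                                   (indicator-yes (P? n) (all n ≤-refl)) ⟩
      n + 1                         ≡⟨ +-comm n 1 ⟩
      suc n                         ∎
      where open ≡-Reasoning

  count-cong : {P Q : ℕ → Set} (P? : Decidable P) (Q? : Decidable Q) (n : ℕ) →
    (∀ k → k < n → P k → Q k) → (∀ k → k < n → Q k → P k) → count P? n ≡ count Q? n
  count-cong P? Q? zero    f g = refl
  count-cong P? Q? (suc n) f g =
    cong₂ _+_ (count-cong P? Q? n (λ k k<n → f k (m<n⇒m<1+n k<n)) (λ k k<n → g k (m<n⇒m<1+n k<n)))
              (indicator-cong (P? n) (Q? n) (f n ≤-refl) (g n ≤-refl))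

  count-+ : {P : ℕ → Set} (P? : Decidable P) (m n : ℕ) →
    count P? (m + n) ≡ count P? m + count (λ k → P? (m + k)) n
  count-+ P? m zero    = trans (cong (count P?) (+-identityʳ m)) (sym (+-identityʳ _))
  count-+ P? m (suc n) = begin
    count P? (m + suc n)                                              ≡⟨ cong (count P?) (+-suc m n) ⟩
    count P? (m + n) + indicator (P? (m + n))                         ≡⟨ cong (_+ indicator (P? (m + n))) (count-+ P? m n) ⟩
    count P? m + count (λ k → P? (m + k)) n + indicator (P? (m + n))  ≡⟨ +-assoc (count P? m) _ _ ⟩
    count P? m + count (λ k → P? (m + k)) (suc n)                     ∎
    where open ≡-Reasoning

  Periodic : ℕ → (ℕ → Set) → Set
  Periodic m P = ∀ k → P (m + k) ⇔ P k

  count-periodic : {P : ℕ → Set} (P? : Decidable P) (m q : ℕ) → Periodic m P →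
    count P? (q * m) ≡ q * count P? m
  count-periodic P? m zero    per = refl
  count-periodic {P} P? m (suc q) per = begin
    count P? (m + q * m)                          ≡⟨ count-+ P? m (q * m) ⟩
    count P? m + count (λ k → P? (m + k)) (q * m) ≡⟨ cong (count P? m +_) (count-periodic P?ₘ m q per′) ⟩
    count P? m + q * count P?ₘ m                  ≡⟨ cong (λ c → count P? m + q * c) (count-cong P?ₘ P? m
                                                        (λ k _ → to (per k)) (λ k _ → from (per k))) ⟩
    count P? m + q * count P? m                   ∎
    where
    open ≡-Reasoning
    open Equivalence
    P?ₘ : Decidable (λ k → P (m + k))
    P?ₘ k = P? (m + k)
    per′ : Periodic m (λ k → P (m + k))
    per′ k = per (m + k)

  private
    count-rotate : {P : ℕ → Set} (P? : Decidable P) (n : ℕ) → P n ⇔ P 0 →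
      count (λ k → P? (suc k)) n ≡ count P? n
    count-rotate P? n Pn⇔P0 = +-cancelʳ-≡ (indicator (P? 0)) _ _ (begin
      count (λ k → P? (suc k)) n + indicator (P? 0) ≡⟨ +-comm _ (indicator (P? 0)) ⟩
      indicator (P? 0) + count (λ k → P? (suc k)) n ≡⟨ count-+ P? 1 n ⟨
      count P? n + indicator (P? n)                 ≡⟨ cong (count P? n +_) (indicator-cong (P? n) (P? 0) to from) ⟩
      count P? n + indicator (P? 0)                 ∎)
      where
      open ≡-Reasoning
      open Equivalence Pn⇔P0

  count-shift : {P : ℕ → Set} (P? : Decidable P) (n : ℕ) → Periodic n P →
    (b : ℕ) → count (λ k → P? (b + k)) n ≡ count P? n
  count-shift P? n per zero    = refl
  count-shift {P} P? n per (suc b) = begin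
    count (λ k → P? (suc b + k)) n ≡⟨ count-cong (λ k → P? (suc b + k)) (λ k → P? (b + suc k)) n
                                        (λ k _ → subst P (sym (+-suc b k))) (λ k _ → subst P (+-suc b k)) ⟩
    count (λ k → P? (b + suc k)) n ≡⟨ count-rotate (λ k → P? (b + k)) n (mk⇔
                                        (λ x → subst P (sym (+-identityʳ b)) (to (per b) (subst P (+-comm b n) x)))
                                        (λ x → subst P (+-comm n b) (from (per b) (subst P (+-identityʳ b) x)))) ⟩
    count (λ k → P? (b + k)) n     ≡⟨ count-shift P? n per b ⟩
    count P? n                     ∎
    where
    open ≡-Reasoning
    open Equivalence

  count-disjoint-union : {P Q R : ℕ → Set} (P? : Decidable P) (Q? : Decidable Q) (R? : Decidable R) (n : ℕ) →
    (∀ k → k < n → P k → Q k ⊎ R k) → (∀ k → k < n → Q k → P k) → (∀ k → k < n → R k → P k) →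
    (∀ k → k < n → Q k → ¬ R k) →
    count P? n ≡ count Q? n + count R? n
  count-disjoint-union P? Q? R? zero    P⇒ Q⇒ R⇒ disj = refl
  count-disjoint-union P? Q? R? (suc n) P⇒ Q⇒ R⇒ disj = begin
    count P? n + indicator (P? n)
      ≡⟨ cong₂ _+_ (count-disjoint-union P? Q? R? n (λ k k<n → P⇒ k (m<n⇒m<1+n k<n))
           (λ k k<n → Q⇒ k (m<n⇒m<1+n k<n)) (λ k k<n → R⇒ k (m<n⇒m<1+n k<n)) (λ k k<n → disj k (m<n⇒m<1+n k<n)))
           (split (P? n) (Q? n) (R? n)) ⟩
    (count Q? n + count R? n) + (indicator (Q? n) + indicator (R? n))
      ≡⟨ interchange (count Q? n) (count R? n) _ _ ⟩
    (count Q? n + indicator (Q? n)) + (count R? n + indicator (R? n))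
      ∎
    where
    open ≡-Reasoning
    split : ∀ x y z → indicator x ≡ indicator y + indicator z
    split (yes p) (yes q) (yes r) = ⊥-elim (disj n ≤-refl q r)
    split (yes p) (yes q) (no r)  = refl
    split (yes p) (no q)  (yes r) = refl
    split (yes p) (no q)  (no r)  = ⊥-elim ([ q , r ]′ (P⇒ n ≤-refl p))
    split (no p)  (yes q) z       = ⊥-elim (p (Q⇒ n ≤-refl q))
    split (no p)  (no q)  (yes r) = ⊥-elim (p (R⇒ n ≤-refl r))
    split (no p)  (no q)  (no r)  = refl

  count-split : ∀ {Q R : ℕ → Set} (R? : Decidable R) (Q? : Decidable Q) n →
    count Q? n ≡ count (λ j → R? j ×-dec Q? j) n + count (λ j → ¬? (R? j) ×-dec Q? j) n
  count-split {Q} {R} R? Q? n = count-disjoint-union Q? (λ j → R? j ×-dec Q? j) (λ j → ¬? (R? j) ×-dec Q? j) n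
    (λ k _ → by-cases (R? k)) (λ _ _ → proj₂) (λ _ _ → proj₂) (λ _ _ (r , _) (¬r , _) → ¬r r)
    where
    by-cases : ∀ {k} → Dec (R k) → Q k → (R k × Q k) ⊎ (¬ R k × Q k)
    by-cases (yes r) q = inj₁ (r , q)
    by-cases (no ¬r) q = inj₂ (¬r , q)

  private
    without : {Q : ℕ → Set} → Decidable Q → (v : ℕ) → Decidable (λ k → Q k × ¬ k ≡ v)
    without Q? v k = Q? k ×-dec ¬? (k ≟ v)

    count-without : {Q : ℕ → Set} (Q? : Decidable Q) (m v : ℕ) → v < m → Q v →
      count Q? m ≡ suc (count (without Q? v) m)
    count-without {Q} Q? (suc m) v v<1+m Qv = last-or-earlier (m ≟ v)
      where
      last-or-earlier : Dec (m ≡ v) → count Q? (suc m) ≡ suc (count (without Q? v) (suc m))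
      last-or-earlier (yes refl) = begin
        count Q? m + indicator (Q? m)
          ≡⟨ cong₂ _+_ (count-cong Q? (without Q? m) m (λ k k<m Qk → Qk , <⇒≢ k<m) (λ k _ → proj₁))
                       (indicator-yes (Q? m) Qv) ⟩
        count (without Q? m) m + 1
          ≡⟨ +-comm _ 1 ⟩
        suc (count (without Q? m) m)
          ≡⟨ cong suc (+-identityʳ _) ⟨
        suc (count (without Q? m) m + 0)
          ≡⟨ cong (λ i → suc (count (without Q? m) m + i)) (indicator-no (without Q? m m) (λ (_ , m≢m) → m≢m refl)) ⟨
        suc (count (without Q? m) (suc m))
          ∎
        where open ≡-Reasoning
      last-or-earlier (no m≢v) = cong₂ _+_ (count-without Q? m v (≤∧≢⇒< (≤-pred v<1+m) (≢-sym m≢v)) Qv)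
                                           (indicator-cong (Q? m) (without Q? v m) (_, m≢v) proj₁)

  count-≤-injection : {P Q : ℕ → Set} (P? : Decidable P) (Q? : Decidable Q) (n m : ℕ) (f : ℕ → ℕ) →
    (∀ k → k < n → P k → f k < m × Q (f k)) →
    (∀ i j → i < n → j < n → P i → P j → f i ≡ f j → i ≡ j) →
    count P? n ≤ count Q? m
  count-≤-injection P? Q? zero    m f maps inj = z≤n
  count-≤-injection {P} {Q} P? Q? (suc n) m f maps inj with P? n
  ... | no _ = subst (_≤ count Q? m) (sym (+-identityʳ _))
                 (count-≤-injection P? Q? n m f (λ k k<n → maps k (m<n⇒m<1+n k<n))
                   (λ i j i<n j<n → inj i j (m<n⇒m<1+n i<n) (m<n⇒m<1+n j<n)))
  ... | yes Pn = begin
    count P? n + 1                  ≡⟨ +-comm _ 1 ⟩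
    suc (count P? n)                ≤⟨ s≤s (count-≤-injection P? (without Q? (f n)) n m f maps′ inj′) ⟩
    suc (count (without Q? (f n)) m) ≡⟨ count-without Q? m (f n) (proj₁ (maps n ≤-refl Pn)) (proj₂ (maps n ≤-refl Pn)) ⟨
    count Q? m                      ∎
    where
    open ≤-Reasoning
    inj′ : ∀ i j → i < n → j < n → P i → P j → f i ≡ f j → i ≡ j
    inj′ i j i<n j<n = inj i j (m<n⇒m<1+n i<n) (m<n⇒m<1+n j<n)
    maps′ : ∀ k → k < n → P k → f k < m × (Q (f k) × ¬ f k ≡ f n)
    maps′ k k<n Pk = let (fk<m , Qfk) = maps k (m<n⇒m<1+n k<n) Pk in
      fk<m , Qfk , λ fk≡fn → <⇒≢ k<n (inj k n (m<n⇒m<1+n k<n) ≤-refl Pk Pn fk≡fn)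

  count-bijection : {P Q : ℕ → Set} (P? : Decidable P) (Q? : Decidable Q) (n m : ℕ) (f g : ℕ → ℕ) →
    (∀ k → k < n → P k → f k < m × Q (f k)) →
    (∀ i j → i < n → j < n → P i → P j → f i ≡ f j → i ≡ j) →
    (∀ k → k < m → Q k → g k < n × P (g k)) →
    (∀ i j → i < m → j < m → Q i → Q j → g i ≡ g j → i ≡ j) →
    count P? n ≡ count Q? m
  count-bijection P? Q? n m f g f-maps f-inj g-maps g-inj =
    ≤-antisym (count-≤-injection P? Q? n m f f-maps f-inj) (count-≤-injection Q? P? m n g g-maps g-inj)

  length-filter-upTo : {P : ℕ → Set} (P? : Decidable P) (n : ℕ) → length (filter P? (upTo n)) ≡ count P? n
  length-filter-upTo P? zero    = refl
  length-filter-upTo P? (suc n) = begin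
    length (filter P? (upTo (suc n)))                            ≡⟨ cong (length ∘ filter P?) (upTo-∷ʳ n) ⟨
    length (filter P? (upTo n ++ n ∷ []))                         ≡⟨ cong length (filter-++ P? (upTo n) (n ∷ [])) ⟩
    length (filter P? (upTo n) ++ filter P? (n ∷ []))             ≡⟨ length-++ (filter P? (upTo n)) ⟩
    length (filter P? (upTo n)) + length (filter P? (n ∷ []))     ≡⟨ cong₂ _+_ (length-filter-upTo P? n) singleton ⟩
    count P? n + indicator (P? n)                                 ∎
    where
    open ≡-Reasoning
    singleton : length (filter P? (n ∷ [])) ≡ indicator (P? n)
    singleton with P? n
    ... | yes _ = refl
    ... | no _  = refl

  length-filter-map : {P : ℕ → Set} (P? : Decidable P) (f : ℕ → ℕ) (xs : List ℕ) →
    length (filter P? (map f xs)) ≡ length (filter (λ k → P? (f k)) xs)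
  length-filter-map P? f []       = refl
  length-filter-map P? f (x ∷ xs) with P? (f x)
  ... | yes _ = cong suc (length-filter-map P? f xs)
  ... | no _  = length-filter-map P? f xs

  hasSize-count : {P : ℕ → Set} (P? : Decidable P) (n : ℕ) → HasSize n P (count P? n)
  hasSize-count P? n = filter P? (upTo n) , filter⁺ P? (upTo⁺ n) , length-filter-upTo P? n , λ k → mk⇔
    (λ k∈ → let (k∈upTo , Pk) = ∈-filter⁻ P? k∈ in ∈-upTo⁻ k∈upTo , Pk)
    (λ (k<n , Pk) → ∈-filter⁺ P? (∈-upTo⁺ k<n) Pk)

  hasSize-cong : ∀ {n m} {P Q : ℕ → Set} → (∀ k → k < n → P k → Q k) → (∀ k → k < n → Q k → P k) →
    HasSize n P m → HasSize n Q m
  hasSize-cong P⇒Q Q⇒P (xs , unique , len , mem) = xs , unique , len , λ k → mk⇔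
    (λ k∈ → let (k<n , Pk) = to (mem k) k∈ in k<n , P⇒Q k k<n Pk)
    (λ (k<n , Qk) → from (mem k) (k<n , Q⇒P k k<n Qk))
    where open Equivalence

  -- The largest k < n with P k, or 0 if there is none.
  search : {P : ℕ → Set} → Decidable P → ℕ → ℕ
  search P? zero = 0
  search P? (suc n) with P? n
  ... | yes _ = n
  ... | no _  = search P? n

  search-sound : {P : ℕ → Set} (P? : Decidable P) (n : ℕ) → (∃ λ k → k < n × P k) →
    search P? n < n × P (search P? n)
  search-sound P? (suc n) (k , k<1+n , Pk) with P? n
  ... | yes Pn = ≤-refl , Pn
  ... | no ¬Pn with k ≟ n
  ...   | yes refl = ⊥-elim (¬Pn Pk)
  ...   | no k≢n   = let (s<n , Ps) = search-sound P? n (k , ≤∧≢⇒< (≤-pred k<1+n) k≢n , Pk) in m<n⇒m<1+n s<n , Ps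

module QuadraticResidues where

  open Counting

  open import Data.Bool.Base using (Bool; true; false; T)
  open import Data.Bool.ListAction using (any)
  open import Data.Empty using (⊥; ⊥-elim)
  open import Data.Integer.Base as ℤ hiding (suc; pred; ∣_∣; _/_)
  open import Data.Integer.DivMod using (_%ℕ_; _/ℕ_; a≡a%ℕn+[a/ℕn]*n; n%ℕd<d)
  open import Data.Integer.Divisibility.Signed
  open import Data.Integer.Properties
  open import Data.Integer.Tactic.RingSolver using (solve)
  open import Data.List.Base using (_∷_; []; length; filter; upTo)
  open import Data.List.Membership.Propositional using (lose)
  open import Data.List.Membership.Propositional.Properties using (∈-upTo⁺)
  open import Data.List.Relation.Unary.AllPairs using ([])
  open import Data.List.Relation.Unary.Any using (satisfied)
  open import Data.List.Relation.Unary.Any.Properties using (any⁺; any⁻)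
  open import Data.Nat.Base as ℕ using (ℕ; zero; suc; z≤n; s≤s)
  open import Data.Nat.Coprimality using (Coprime; coprime?; coprime-divisor; coprime-Bézout)
  import Data.Nat.Divisibility as ℕD
  open import Data.Nat.GCD using (module Bézout)
  open import Data.Nat.Primality using (Prime; euclidsLemma; prime⇒nonZero; prime⇒nonTrivial; prime⇒irreducible; composite-≢)
  import Data.Nat.Properties as ℕP
  open import Data.Nat.Tactic.RingSolver using () renaming (solve-∀ to ℕ-solve-∀)
  open import Data.Product.Base using (_×_; _,_; proj₁; proj₂; ∃)
  open import Data.Rational.Base using (_/_; toℚᵘ) renaming (_+_ to _+ℚ_)
  open import Data.Rational.Properties using (toℚᵘ-injective; toℚᵘ-fromℚᵘ; toℚᵘ-homo-+)
  open import Data.Rational.Unnormalised.Base using (mkℚᵘ; *≡*) renaming (_+_ to _+ᵘ_)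
  import Data.Rational.Unnormalised.Properties as ℚᵘ
  open import Data.Sum.Base as Sum using (_⊎_; inj₁; inj₂)
  open import Data.Unit.Base using (⊤; tt)
  open import Defs
  open import Function.Base using (id)
  open import Function.Bundles using (_⇔_; mk⇔; module Equivalence)
  open import Relation.Binary.Bundles using (Setoid)
  open import Relation.Binary.Definitions using (tri<; tri≈; tri>)
  open import Relation.Binary.PropositionalEquality
  open import Relation.Nullary using (Dec; yes; no; ¬_)
  open import Relation.Nullary.Decidable using (_×-dec_; ¬?; map′; ⌊_⌋; toWitness; fromWitness)
  open import Relation.Unary using (Decidable)

  infixl 1 _∣-by_
  _∣-by_ : ∀ {k x y} → k ∣ x → x ≡ y → k ∣ y
  k∣x ∣-by refl = k∣x

  ∣0 : ∀ {k} → k ∣ 0ℤ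
  ∣0 = divides 0ℤ refl

  -- A record rather than a synonym for divisibility, so that a, b and n can be inferred.
  record _≈_[_] (a b : ℤ) (n : ℕ) : Set where
    constructor mk≈
    field un≈ : + n ∣ a - b
  open _≈_[_] public
  infix 4 _≈_[_]

  module _ {n : ℕ} where

    ≈-refl : ∀ {a} → a ≈ a [ n ]
    ≈-refl {a} = mk≈ (∣0 ∣-by solve (a ∷ []))

    ≈-reflexive : ∀ {a b} → a ≡ b → a ≈ b [ n ]
    ≈-reflexive refl = ≈-refl

    ≈-sym : ∀ {a b} → a ≈ b [ n ] → b ≈ a [ n ]
    ≈-sym {a} {b} (mk≈ d) = mk≈ (∣m⇒∣-m d ∣-by solve (a ∷ b ∷ []))

    ≈-trans : ∀ {a b c} → a ≈ b [ n ] → b ≈ c [ n ] → a ≈ c [ n ]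
    ≈-trans {a} {b} {c} (mk≈ d) (mk≈ e) = mk≈ (∣m∣n⇒∣m+n d e ∣-by solve (a ∷ b ∷ c ∷ []))

    ≈-+ : ∀ {a b c d} → a ≈ b [ n ] → c ≈ d [ n ] → a + c ≈ b + d [ n ]
    ≈-+ {a} {b} {c} {d} (mk≈ x) (mk≈ y) = mk≈ (∣m∣n⇒∣m+n x y ∣-by solve (a ∷ b ∷ c ∷ d ∷ []))

    ≈-* : ∀ {a b c d} → a ≈ b [ n ] → c ≈ d [ n ] → a * c ≈ b * d [ n ]
    ≈-* {a} {b} {c} {d} (mk≈ x) (mk≈ y) =
      mk≈ (∣m∣n⇒∣m+n (∣m⇒∣m*n c x) (∣n⇒∣m*n b y) ∣-by solve (a ∷ b ∷ c ∷ d ∷ []))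

    ≈-neg : ∀ {a b} → a ≈ b [ n ] → - a ≈ - b [ n ]
    ≈-neg {a} {b} (mk≈ x) = mk≈ (∣m⇒∣-m x ∣-by solve (a ∷ b ∷ []))

    ≈-*ˡ : ∀ {a b} c → a ≈ b [ n ] → c * a ≈ c * b [ n ]
    ≈-*ˡ c = ≈-* (≈-refl {c})

    ≈-*ʳ : ∀ {a b} c → a ≈ b [ n ] → a * c ≈ b * c [ n ]
    ≈-*ʳ c a≈b = ≈-* a≈b (≈-refl {c})

    ≈-+ˡ : ∀ {a b} c → a ≈ b [ n ] → c + a ≈ c + b [ n ]
    ≈-+ˡ c = ≈-+ (≈-refl {c})

    ≈-+ʳ : ∀ {a b} c → a ≈ b [ n ] → a + c ≈ b + c [ n ]
    ≈-+ʳ c a≈b = ≈-+ a≈b (≈-refl {c})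

    ∣-resp-≈ : ∀ {a b} → a ≈ b [ n ] → + n ∣ a → + n ∣ b
    ∣-resp-≈ {a} {b} (mk≈ x) d = ∣m∣n⇒∣m-n d x ∣-by solve (a ∷ b ∷ [])

    ≈0⇒∣ : ∀ {a} → a ≈ 0ℤ [ n ] → + n ∣ a
    ≈0⇒∣ {a} (mk≈ d) = d ∣-by solve (a ∷ [])

    ∤-resp-≈ : ∀ {a b} → a ≈ b [ n ] → ¬ + n ∣ a → ¬ + n ∣ b
    ∤-resp-≈ a≈b n∤a n∣b = n∤a (∣-resp-≈ (≈-sym a≈b) n∣b)

  ≈-setoid : ℕ → Setoid _ _
  ≈-setoid n = record
    { Carrier = ℤ ; _≈_ = _≈_[ n ]
    ; isEquivalence = record { refl = ≈-refl ; sym = ≈-sym ; trans = ≈-trans } }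

  module ≈-Reasoning (n : ℕ) where
    open import Relation.Binary.Reasoning.Setoid (≈-setoid n) public

  ≈-weaken : ∀ {m n a b} → + m ∣ + n → a ≈ b [ n ] → a ≈ b [ m ]
  ≈-weaken m∣n (mk≈ d) = mk≈ (∣-trans m∣n d)

  private
    ordered-residues-≈⇒≡ : ∀ {n r s} → r ℕ.< n → s ℕ.≤ r → + r ≈ + s [ n ] → r ≡ s
    ordered-residues-≈⇒≡ {n} {r} {s} r<n s≤r (mk≈ d)
      with r ℕ.∸ s in r∸s≡ | ∣⇒∣ᵤ (d ∣-by trans (m-n≡m⊖n r s) (⊖-≥ s≤r))
    ... | zero  | _     = ℕP.≤-antisym (ℕP.m∸n≡0⇒m≤n r∸s≡) s≤r
    ... | suc _ | n∣r∸s = ⊥-elim (ℕP.<⇒≱ (ℕP.≤-<-trans (subst (ℕ._≤ r) r∸s≡ (ℕP.m∸n≤m r s)) r<n) (ℕD.∣⇒≤ n∣r∸s))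

  residues-≈⇒≡ : ∀ {n r s} → r ℕ.< n → s ℕ.< n → + r ≈ + s [ n ] → r ≡ s
  residues-≈⇒≡ {r = r} {s} r<n s<n r≈s with ℕP.≤-total s r
  ... | inj₁ s≤r = ordered-residues-≈⇒≡ r<n s≤r r≈s
  ... | inj₂ r≤s = sym (ordered-residues-≈⇒≡ s<n r≤s (≈-sym r≈s))

  ∤-nonzero-residue : ∀ {n r} → 0 ℕ.< r → r ℕ.< n → ¬ + n ∣ + r
  ∤-nonzero-residue {r = suc r} _ r<n n∣r = ℕP.<⇒≱ r<n (ℕD.∣⇒≤ (∣⇒∣ᵤ n∣r))

  opaque
    residue : (n : ℕ) .{{_ : ℕ.NonZero n}} → ℤ → ℕ
    residue n x = x %ℕ n

    residue-< : ∀ n .{{_ : ℕ.NonZero n}} x → residue n x ℕ.< n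
    residue-< n x = n%ℕd<d x n

    residue-≈ : ∀ n .{{_ : ℕ.NonZero n}} x → + residue n x ≈ x [ n ]
    residue-≈ n x = ≈-sym (mk≈ (divides (x /ℕ n) (sub-remainder (+ (x %ℕ n)) (x /ℕ n) (+ n) (a≡a%ℕn+[a/ℕn]*n x n))))
      where
      sub-remainder : ∀ {x} r q n → x ≡ r + q * n → x - r ≡ q * n
      sub-remainder r q n refl = solve (r ∷ q ∷ n ∷ [])

  2*[1+m]≈1 : ∀ m → + 2 * + suc m ≈ 1ℤ [ suc (m ℕ.+ m) ]
  2*[1+m]≈1 m = mk≈ (divides 1ℤ (begin
    + 2 * + suc m - 1ℤ           ≡⟨ cong (λ z → + 2 * z - 1ℤ) (pos-+ 1 m) ⟩
    + 2 * (1ℤ + + m) - 1ℤ        ≡⟨ doubled (+ m) ⟩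
    1ℤ * (1ℤ + (+ m + + m))      ≡⟨ cong (λ z → 1ℤ * (1ℤ + z)) (pos-+ m m) ⟨
    1ℤ * (1ℤ + + (m ℕ.+ m))      ≡⟨ cong (1ℤ *_) (pos-+ 1 (m ℕ.+ m)) ⟨
    1ℤ * + suc (m ℕ.+ m)         ∎))
    where
    open ≡-Reasoning
    doubled : ∀ m → + 2 * (1ℤ + m) - 1ℤ ≡ 1ℤ * (1ℤ + (m + m))
    doubled m = solve (m ∷ [])

  infix 4 _≈?_[_]
  _≈?_[_] : ∀ a b n → Dec (a ≈ b [ n ])
  a ≈? b [ n ] = map′ mk≈ un≈ (+ n ∣? (a - b))

  ≈-scale : ∀ {n a b} k → a ≈ b [ n ] → + k * a ≈ + k * b [ k ℕ.* n ]
  ≈-scale {n} {a} {b} k (mk≈ (divides q e)) =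
    mk≈ (divides q (trans (scale-difference (+ k) a b q (+ n) e) (cong (q *_) (sym (pos-* k n)))))
    where
    scale-difference : ∀ K a b q N → a - b ≡ q * N → K * a - K * b ≡ q * (K * N)
    scale-difference K a b q N e = begin
      K * a - K * b ≡⟨ solve (K ∷ a ∷ b ∷ []) ⟩
      K * (a - b)   ≡⟨ cong (K *_) e ⟩
      K * (q * N)   ≡⟨ solve (K ∷ q ∷ N ∷ []) ⟩
      q * (K * N)   ∎
      where open ≡-Reasoning

  ≈-unscale : ∀ {n a b} k .{{_ : ℕ.NonZero k}} → + k * a ≈ + k * b [ k ℕ.* n ] → a ≈ b [ n ]
  ≈-unscale {n} {a} {b} k (mk≈ (divides q e)) = mk≈ (divides q (*-cancelˡ-≡ (+ k) (a - b) (q * + n)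
    (factor (+ k) a b q (+ n) (trans e (cong (q *_) (pos-* k n))))))
    where
    factor : ∀ K a b q N → K * a - K * b ≡ q * (K * N) → K * (a - b) ≡ K * (q * N)
    factor K a b q N e = begin
      K * (a - b)     ≡⟨ solve (K ∷ a ∷ b ∷ []) ⟩
      K * a - K * b   ≡⟨ e ⟩
      q * (K * N)     ≡⟨ solve (q ∷ K ∷ N ∷ []) ⟩
      K * (q * N)     ∎
      where open ≡-Reasoning

  SquareMod : ℕ → ℤ → Set
  SquareMod n c = ∃ λ x → x * x ≈ c [ n ]

  SquareMod-resp-≈ : ∀ {n a b} → a ≈ b [ n ] → SquareMod n a → SquareMod n b
  SquareMod-resp-≈ a≈b (x , xx≈a) = x , ≈-trans xx≈a a≈b

  SquareMod-weaken : ∀ {m n c} → + m ∣ + n → SquareMod n c → SquareMod m c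
  SquareMod-weaken m∣n (x , xx≈c) = x , ≈-weaken m∣n xx≈c

  SquareMod-1 : ∀ c → SquareMod 1 c
  SquareMod-1 c = 0ℤ , mk≈ (divides (0ℤ - c) (sym (*-identityʳ _)))

  SquareMod-residue : ∀ {n c} .{{_ : ℕ.NonZero n}} → SquareMod n c → ∃ λ r → r ℕ.< n × + r * + r ≈ c [ n ]
  SquareMod-residue {n} (x , xx≈c) = residue n x , residue-< n x , ≈-trans (≈-* (residue-≈ n x) (residue-≈ n x)) xx≈c

  opaque
    squareMod? : ∀ n .{{_ : ℕ.NonZero n}} c → Dec (SquareMod n c)
    squareMod? n c = map′ (λ (r , _ , rr≈c) → + r , rr≈c) SquareMod-residue
                          (ℕP.anyUpTo? (λ r → + r * + r ≈? c [ n ]) n)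

  RespectsMod : ℕ → (ℕ → Set) → Set
  RespectsMod n P = ∀ {j k} → + j ≈ + k [ n ] → P j → P k

  respectsMod⇒periodic : ∀ {n P} → RespectsMod n P → Periodic n P
  respectsMod⇒periodic {n} resp k = mk⇔ (resp n+k≈k) (resp (≈-sym n+k≈k))
    where
    shifted : ∀ N K → N + K - K ≡ 1ℤ * N
    shifted N K = solve (N ∷ K ∷ [])
    n+k≈k : + (n ℕ.+ k) ≈ + k [ n ]
    n+k≈k = mk≈ (divides 1ℤ (trans (cong (_- + k) (pos-+ n k)) (shifted (+ n) (+ k))))

  count-multiples : ∀ n .{{_ : ℕ.NonZero n}} {Q : ℕ → Set} (Q? : Decidable Q) M →
    count (λ j → (+ n ∣? + j) ×-dec Q? j) (M ℕ.* n) ≡ count (λ i → Q? (i ℕ.* n)) M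
  count-multiples n Q? zero    = refl
  count-multiples n@(suc n-1) {Q} Q? (suc M) = begin
    count (λ j → (+ n ∣? + j) ×-dec Q? j) (n ℕ.+ M ℕ.* n)
      ≡⟨ count-+ (λ j → (+ n ∣? + j) ×-dec Q? j) n (M ℕ.* n) ⟩
    count (λ j → (+ n ∣? + j) ×-dec Q? j) n ℕ.+ count (λ j → (+ n ∣? + (n ℕ.+ j)) ×-dec Q? (n ℕ.+ j)) (M ℕ.* n)
      ≡⟨ cong₂ ℕ._+_ first-block (count-cong _ (λ j → (+ n ∣? + j) ×-dec Q? (n ℕ.+ j)) (M ℕ.* n)
           (λ j _ (n∣n+j , q) → ∣m+n∣m⇒∣n (n∣n+j ∣-by pos-+ n j) ∣-refl , q)
           (λ j _ (n∣j , q) → (∣m∣n⇒∣m+n ∣-refl n∣j ∣-by sym (pos-+ n j)) , q)) ⟩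
    indicator (Q? 0) ℕ.+ count (λ j → (+ n ∣? + j) ×-dec Q? (n ℕ.+ j)) (M ℕ.* n)
      ≡⟨ cong (indicator (Q? 0) ℕ.+_) (count-multiples n (λ j → Q? (n ℕ.+ j)) M) ⟩
    indicator (Q? 0) ℕ.+ count (λ i → Q? (n ℕ.+ i ℕ.* n)) M
      ≡⟨ count-+ (λ i → Q? (i ℕ.* n)) 1 M ⟨
    count (λ i → Q? (i ℕ.* n)) (suc M)
      ∎
    where
    open ≡-Reasoning
    first-block : count (λ j → (+ n ∣? + j) ×-dec Q? j) n ≡ indicator (Q? 0)
    first-block = begin
      count (λ j → (+ n ∣? + j) ×-dec Q? j) (1 ℕ.+ n-1)
        ≡⟨ count-+ (λ j → (+ n ∣? + j) ×-dec Q? j) 1 n-1 ⟩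
      indicator ((+ n ∣? 0ℤ) ×-dec Q? 0) ℕ.+ count (λ j → (+ n ∣? + suc j) ×-dec Q? (suc j)) n-1
        ≡⟨ cong₂ ℕ._+_ (indicator-cong _ (Q? 0) proj₂ (∣0 ,_))
             (count-none _ n-1 (λ j j<n-1 (n∣1+j , _) → ∤-nonzero-residue (s≤s z≤n) (s≤s j<n-1) n∣1+j)) ⟩
      indicator (Q? 0) ℕ.+ 0
        ≡⟨ ℕP.+-identityʳ _ ⟩
      indicator (Q? 0)
        ∎

  module _ {p : ℕ} (pp : Prime p) where

    private instance
      p-nonZero : ℕ.NonZero p
      p-nonZero = prime⇒nonZero pp

    1<p : 1 ℕ.< p
    1<p = ℕ.nonTrivial⇒n>1 p {{prime⇒nonTrivial pp}}

    ∣*⇒∣⊎∣ : ∀ x y → + p ∣ x * y → + p ∣ x ⊎ + p ∣ y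
    ∣*⇒∣⊎∣ x y p∣xy = Sum.map ∣ᵤ⇒∣ ∣ᵤ⇒∣ (euclidsLemma ℤ.∣ x ∣ ℤ.∣ y ∣ pp (subst (p ℕD.∣_) (abs-* x y) (∣⇒∣ᵤ p∣xy)))

    ∤*∤⇒∤* : ∀ {x y} → ¬ + p ∣ x → ¬ + p ∣ y → ¬ + p ∣ x * y
    ∤*∤⇒∤* {x} {y} p∤x p∤y p∣xy = Sum.[ p∤x , p∤y ]′ (∣*⇒∣⊎∣ x y p∣xy)

    ∣x*x⇒∣x : ∀ {x} → + p ∣ x * x → + p ∣ x
    ∣x*x⇒∣x {x} p∣xx = Sum.reduce (∣*⇒∣⊎∣ x x p∣xx)

    ≈-cancel-unit : ∀ {e a b} → ¬ + p ∣ e → a * e ≈ b * e [ p ] → a ≈ b [ p ]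
    ≈-cancel-unit {e} {a} {b} p∤e (mk≈ d) =
      Sum.[ mk≈ , (λ p∣e → ⊥-elim (p∤e p∣e)) ]′ (∣*⇒∣⊎∣ (a - b) e (d ∣-by solve (a ∷ b ∷ e ∷ [])))

    square-≈⇒≈± : ∀ {a b} → a * a ≈ b * b [ p ] → a ≈ b [ p ] ⊎ a ≈ - b [ p ]
    square-≈⇒≈± {a} {b} (mk≈ d) with ∣*⇒∣⊎∣ (a - b) (a + b) (d ∣-by solve (a ∷ b ∷ []))
    ... | inj₁ p∣a-b = inj₁ (mk≈ p∣a-b)
    ... | inj₂ p∣a+b = inj₂ (mk≈ (p∣a+b ∣-by solve (a ∷ b ∷ [])))

    ∣-root-of-multiple : ∀ {n x z} → + p ∣ + n → x * x ≈ + p * z [ n ] → + p ∣ x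
    ∣-root-of-multiple p∣n xx≈pz = ∣x*x⇒∣x (∣-resp-≈ (≈-sym (≈-weaken p∣n xx≈pz)) (∣m⇒∣m*n _ ∣-refl))

    private
      coprime-∤ : ∀ {m} → ¬ + p ∣ + m → ∀ {d} → d ℕD.∣ m × d ℕD.∣ p → d ≡ 1
      coprime-∤ p∤m (d∣m , d∣p) with prime⇒irreducible pp d∣p
      ... | inj₁ d≡1    = d≡1
      ... | inj₂ refl   = ⊥-elim (p∤m (∣ᵤ⇒∣ d∣m))

      inverse-ℕ : ∀ m → ¬ + p ∣ + m → ∃ λ u → + m * u ≈ 1ℤ [ p ]
      inverse-ℕ m p∤m with coprime-Bézout (coprime-∤ p∤m)
      ... | Bézout.+- x y eq = + x , mk≈ (divides (+ y) (bézout₁ (+ m) (+ x) (+ y) (+ p) (begin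
            + x * + m          ≡⟨ pos-* x m ⟨
            + (x ℕ.* m)        ≡⟨ cong +_ eq ⟨
            + (1 ℕ.+ y ℕ.* p)  ≡⟨ cong (λ z → 1ℤ + z) (pos-* y p) ⟩
            1ℤ + + y * + p     ∎)))
        where
        open ≡-Reasoning
        bézout₁ : ∀ M X Y P → X * M ≡ 1ℤ + Y * P → M * X - 1ℤ ≡ Y * P
        bézout₁ M X Y P e = begin
          M * X - 1ℤ        ≡⟨ solve (M ∷ X ∷ []) ⟩
          X * M - 1ℤ        ≡⟨ cong (_- 1ℤ) e ⟩
          1ℤ + Y * P - 1ℤ   ≡⟨ solve (Y ∷ P ∷ []) ⟩
          Y * P             ∎
      ... | Bézout.-+ x y eq = - + x , mk≈ (divides (- + y) (bézout₂ (+ m) (+ x) (+ y) (+ p) (begin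
            1ℤ + + x * + m     ≡⟨ cong (λ z → 1ℤ + z) (pos-* x m) ⟨
            + (1 ℕ.+ x ℕ.* m)  ≡⟨ cong +_ eq ⟩
            + (y ℕ.* p)        ≡⟨ pos-* y p ⟩
            + y * + p          ∎)))
        where
        open ≡-Reasoning
        bézout₂ : ∀ M X Y P → 1ℤ + X * M ≡ Y * P → M * - X - 1ℤ ≡ - Y * P
        bézout₂ M X Y P e = begin
          M * - X - 1ℤ      ≡⟨ solve (M ∷ X ∷ []) ⟩
          - (1ℤ + X * M)    ≡⟨ cong -_ e ⟩
          - (Y * P)         ≡⟨ solve (Y ∷ P ∷ []) ⟩
          - Y * P           ∎

    inverse : ∀ a → ¬ + p ∣ a → ∃ λ b → a * b ≈ 1ℤ [ p ]
    inverse (+ m)      p∤a = inverse-ℕ m p∤a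
    inverse -[1+ m ]   p∤a with inverse-ℕ (suc m) (λ p∣m → p∤a (∣m⇒∣-m p∣m))
    ... | u , mu≈1 = - u , ≈-trans (≈-reflexive (neg-neg (+ suc m) u)) mu≈1
      where
      neg-neg : ∀ M U → - M * - U ≡ M * U
      neg-neg M U = solve (M ∷ U ∷ [])

    private
      square-of-multiple : ∀ {x} y → x ≡ y * + p → x * x ≡ + p * (+ p * (y * y))
      square-of-multiple {x} y refl = scaled y (+ p)
        where
        scaled : ∀ y P → y * P * (y * P) ≡ P * (P * (y * y))
        scaled y P = solve (y ∷ P ∷ [])

      p∣p*n : ∀ n → + p ∣ + (p ℕ.* n)
      p∣p*n n = ∣ᵤ⇒∣ (ℕD.m∣m*n n)

    SquareMod-p²-cancel : ∀ {M d} → SquareMod (p ℕ.* (p ℕ.* M)) (+ p * (+ p * d)) ⇔ SquareMod M d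
    SquareMod-p²-cancel {M} {d} = mk⇔ cancel (λ (y , yy≈d) →
      y * + p , ≈-trans (≈-reflexive (square-of-multiple y refl)) (≈-scale {p ℕ.* M} p (≈-scale {M} p yy≈d)))
      where
      cancel : SquareMod (p ℕ.* (p ℕ.* M)) (+ p * (+ p * d)) → SquareMod M d
      cancel (x , xx≈) = let divides y x≡yp = ∣-root-of-multiple {x = x} {z = + p * d} (p∣p*n (p ℕ.* M)) xx≈ in
        y , ≈-unscale {M} p (≈-unscale {p ℕ.* M} {+ p * (y * y)} {+ p * d} p
              (≈-trans (≈-reflexive (sym (square-of-multiple y x≡yp))) xx≈))

    ¬SquareMod-p*unit : ∀ {M w} → ¬ + p ∣ w → ¬ SquareMod (p ℕ.* (p ℕ.* M)) (+ p * w)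
    ¬SquareMod-p*unit {M} {w} p∤w (x , xx≈) =
      let divides y x≡yp = ∣-root-of-multiple {x = x} {z = w} (p∣p*n (p ℕ.* M)) xx≈
          pyy≈w = ≈-unscale {p ℕ.* M} {+ p * (y * y)} {w} p (≈-trans (≈-reflexive (sym (square-of-multiple y x≡yp))) xx≈)
      in p∤w (∣-resp-≈ (≈-weaken (p∣p*n M) pyy≈w) (∣m⇒∣m*n _ ∣-refl))

    private
      divisor-of-power : ∀ k {d} → d ℕD.∣ p ℕ.^ k → d ≡ 1 ⊎ p ℕD.∣ d
      divisor-of-power zero    d∣1 = inj₁ (ℕD.∣1⇒≡1 d∣1)
      divisor-of-power (suc k) {d} d∣p^k+1 with p ℕD.∣? d
      ... | yes p∣d = inj₂ p∣d
      ... | no p∤d  = divisor-of-power k (coprime-divisor coprime-d-p d∣p^k+1)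
        where
        coprime-d-p : Coprime d p
        coprime-d-p (c∣d , c∣p) with prime⇒irreducible pp c∣p
        ... | inj₁ c≡1 = c≡1
        ... | inj₂ refl = ⊥-elim (p∤d c∣d)

    coprime-p^⇔∤ : ∀ k m → Coprime m (p ℕ.^ suc k) ⇔ (¬ p ℕD.∣ m)
    coprime-p^⇔∤ k m = mk⇔
      (λ coprime p∣m → ℕP.<-irrefl (sym (coprime (p∣m , ℕD.m∣m*n (p ℕ.^ k)))) 1<p)
      (λ p∤m {c} (c∣m , c∣p^k+1) → Sum.[ id , (λ p∣c → ⊥-elim (p∤m (ℕD.∣-trans p∣c c∣m))) ]′ (divisor-of-power (suc k) c∣p^k+1))

    private
      Unit : ℕ → Set
      Unit k = ¬ p ℕD.∣ suc k

      unit? : Decidable Unit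
      unit? k = ¬? (p ℕD.∣? suc k)

      unit-periodic : Periodic p Unit
      unit-periodic k = mk⇔
        (λ p∤1+p+k p∣1+k → p∤1+p+k (subst (p ℕD.∣_) (ℕP.+-suc p k) (ℕD.∣m∣n⇒∣m+n ℕD.∣-refl p∣1+k)))
        (λ p∤1+k p∣1+p+k → p∤1+k (ℕD.∣m+n∣m⇒∣n (subst (p ℕD.∣_) (sym (ℕP.+-suc p k)) p∣1+p+k) ℕD.∣-refl))

      count-unit : count unit? p ≡ p ℕ.∸ 1
      count-unit = begin
        count unit? p                          ≡⟨ cong (count unit?) p≡1+n ⟩
        count unit? n ℕ.+ indicator (unit? n)  ≡⟨ cong₂ ℕ._+_ (count-all unit? n below) (indicator-no (unit? n) p∣1+n) ⟩
        n ℕ.+ 0                                ≡⟨ ℕP.+-identityʳ n ⟩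
        n                                      ≡⟨ cong (ℕ._∸ 1) p≡1+n ⟨
        p ℕ.∸ 1                                ∎
        where
        open ≡-Reasoning
        n : ℕ
        n = ℕ.pred p
        p≡1+n : p ≡ suc n
        p≡1+n = sym (ℕP.suc-pred p {{prime⇒nonZero pp}})
        p∣1+n : ¬ Unit n
        p∣1+n p∤1+n = p∤1+n (subst (p ℕD.∣_) p≡1+n ℕD.∣-refl)
        below : ∀ k → k ℕ.< n → Unit k
        below k k<n p∣1+k = ℕP.<⇒≱ (subst (suc k ℕ.<_) (sym p≡1+n) (s≤s k<n)) (ℕD.∣⇒≤ p∣1+k)

    φ-p^ : ∀ k → φ (p ℕ.^ suc k) ≡ p ℕ.^ k ℕ.* (p ℕ.∸ 1)
    φ-p^ k = begin
      φ (p ℕ.^ suc k)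
        ≡⟨ length-filter-map (λ m → coprime? m (p ℕ.^ suc k)) suc (upTo (p ℕ.^ suc k)) ⟩
      length (filter (λ m → coprime? (suc m) (p ℕ.^ suc k)) (upTo (p ℕ.^ suc k)))
        ≡⟨ length-filter-upTo (λ m → coprime? (suc m) (p ℕ.^ suc k)) (p ℕ.^ suc k) ⟩
      count (λ m → coprime? (suc m) (p ℕ.^ suc k)) (p ℕ.^ suc k)
        ≡⟨ count-cong _ unit? (p ℕ.^ suc k) (λ m _ → to (coprime-p^⇔∤ k (suc m))) (λ m _ → from (coprime-p^⇔∤ k (suc m))) ⟩
      count unit? (p ℕ.* p ℕ.^ k)
        ≡⟨ cong (count unit?) (ℕP.*-comm p (p ℕ.^ k)) ⟩
      count unit? (p ℕ.^ k ℕ.* p)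
        ≡⟨ count-periodic unit? p (p ℕ.^ k) unit-periodic ⟩
      p ℕ.^ k ℕ.* count unit? p
        ≡⟨ cong (p ℕ.^ k ℕ.*_) count-unit ⟩
      p ℕ.^ k ℕ.* (p ℕ.∸ 1)
        ∎
      where
      open ≡-Reasoning
      open Equivalence

  odd-prime∤2 : ∀ {p} → Prime p → p ≢ 2 → ¬ + p ∣ + 2
  odd-prime∤2 pp p≢2 p∣2 = p≢2 (ℕP.≤-antisym (ℕD.∣⇒≤ (∣⇒∣ᵤ p∣2)) (1<p pp))

  private
    hensel-step : ∀ x c q i r P T → x * x - c ≡ q * (P * T) → + 2 * x * i - 1ℤ ≡ r * P →
      (x - q * i * (P * T)) * (x - q * i * (P * T)) - c ≡ ((q * i) * (q * i) * T - q * r) * (P * (P * T))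
    hensel-step x c q i r P T xx-c 2xi-1 = begin
      (x - q * i * (P * T)) * (x - q * i * (P * T)) - c
        ≡⟨ solve (x ∷ c ∷ q ∷ i ∷ P ∷ T ∷ []) ⟩
      (x * x - c) * (1ℤ - + 2 * x * i) + (x * x - c - q * (P * T)) * (+ 2 * x * i) + (q * i) * (q * i) * (P * T) * (P * T)
        ≡⟨ cong (λ d → d * (1ℤ - + 2 * x * i) + (d - q * (P * T)) * (+ 2 * x * i) + (q * i) * (q * i) * (P * T) * (P * T)) xx-c ⟩
      q * (P * T) * (1ℤ - + 2 * x * i) + (q * (P * T) - q * (P * T)) * (+ 2 * x * i) + (q * i) * (q * i) * (P * T) * (P * T)
        ≡⟨ solve (x ∷ q ∷ i ∷ P ∷ T ∷ []) ⟩
      (q * i) * (q * i) * T * (P * (P * T)) - q * T * P * (+ 2 * x * i - 1ℤ)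
        ≡⟨ cong (λ d → (q * i) * (q * i) * T * (P * (P * T)) - q * T * P * d) 2xi-1 ⟩
      (q * i) * (q * i) * T * (P * (P * T)) - q * T * P * (r * P)
        ≡⟨ solve (q ∷ i ∷ r ∷ P ∷ T ∷ []) ⟩
      ((q * i) * (q * i) * T - q * r) * (P * (P * T))
        ∎
      where open ≡-Reasoning

  -- Newton step: with 2x·i ≡ 1 (mod p), replacing x by x − q·i·p^(t+1) removes the error q·p^(t+1) of x² − c.
  SquareMod-lift : ∀ {p c} → Prime p → p ≢ 2 → ¬ + p ∣ c → SquareMod p c → ∀ t → SquareMod (p ℕ.^ suc t) c
  SquareMod-lift {p} pp p≢2 p∤c sq zero = SquareMod-weaken (∣-reflexive (cong +_ (ℕP.*-identityʳ p))) sq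
  SquareMod-lift {p} {c} pp p≢2 p∤c sq (suc t) with SquareMod-lift pp p≢2 p∤c sq t
  ... | x , xx≈c@(mk≈ (divides q xx-c)) = x - q * i * (P * Pᵗ) , mk≈ (divides lifted-quotient (begin
      (x - q * i * (P * Pᵗ)) * (x - q * i * (P * Pᵗ)) - c  ≡⟨ hensel-step x c q i r P Pᵗ (trans xx-c (cong (q *_) p^t+1≡)) 2xi-1 ⟩
      lifted-quotient * (P * (P * Pᵗ))                          ≡⟨ cong (lifted-quotient *_) (trans (pos-* p (p ℕ.^ suc t)) (cong (P *_) p^t+1≡)) ⟨
      lifted-quotient * + (p ℕ.^ suc (suc t))                   ∎))
    where
    open ≡-Reasoning
    P Pᵗ : ℤ
    P = + p
    Pᵗ = + (p ℕ.^ t)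
    p^t+1≡ : + (p ℕ.^ suc t) ≡ P * Pᵗ
    p^t+1≡ = pos-* p (p ℕ.^ t)
    p∤x : ¬ P ∣ x
    p∤x p∣x = p∤c (∣-resp-≈ (≈-weaken (∣ᵤ⇒∣ (ℕD.m∣m*n (p ℕ.^ t))) xx≈c) (∣m⇒∣m*n x p∣x))
    2x⁻¹ : ∃ λ i → + 2 * x * i ≈ 1ℤ [ p ]
    2x⁻¹ = inverse pp (+ 2 * x) (∤*∤⇒∤* pp (odd-prime∤2 pp p≢2) p∤x)
    i r : ℤ
    i = proj₁ 2x⁻¹
    r = _∣_.quotient (un≈ (proj₂ 2x⁻¹))
    2xi-1 : + 2 * x * i - 1ℤ ≡ r * P
    2xi-1 = _∣_.equality (un≈ (proj₂ 2x⁻¹))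
    lifted-quotient : ℤ
    lifted-quotient = (q * i) * (q * i) * Pᵗ - q * r

  module _ {a : ℤ} {p : ℕ} where

    private
      root-test : ℕ → Bool
      root-test x = ⌊ p ℕD.∣? ℤ.∣ + x * + x - a ∣ ⌋

    legendre≡1⇒square : legendre a p ≡ + 1 → SquareMod p a
    legendre≡1⇒square eq with p ℕD.∣? ℤ.∣ a ∣ | any root-test (upTo p) in found
    legendre≡1⇒square () | yes _ | _
    legendre≡1⇒square () | no _  | false
    legendre≡1⇒square eq | no _  | true  = let (x , x-root) = satisfied (any⁻ root-test (upTo p) (subst T (sym found) tt)) in
                          + x , mk≈ (∣ᵤ⇒∣ (toWitness x-root))

    legendre≡-1⇒nonsquare : .{{_ : ℕ.NonZero p}} → legendre a p ≡ -[1+ 0 ] → ¬ SquareMod p a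
    legendre≡-1⇒nonsquare eq sq with p ℕD.∣? ℤ.∣ a ∣ | any root-test (upTo p) in found
    legendre≡-1⇒nonsquare () sq | yes _ | _
    legendre≡-1⇒nonsquare () sq | no _  | true
    legendre≡-1⇒nonsquare eq sq | no _  | false = let (r , r<p , rr≈a) = SquareMod-residue sq in
      subst T found (any⁺ root-test (lose (∈-upTo⁺ r<p) (fromWitness (∣⇒∣ᵤ (un≈ rr≈a)))))

  odd-prime⇒≡2h+1 : ∀ {p} → Prime p → 2 ≢ p → ∃ λ h → p ≡ suc (h ℕ.+ h)
  odd-prime⇒≡2h+1 {p} pp 2≢p with parity p
    where
    parity : ∀ n → (∃ λ h → n ≡ h ℕ.+ h) ⊎ (∃ λ h → n ≡ suc (h ℕ.+ h))
    parity zero    = inj₁ (0 , refl)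
    parity (suc n) with parity n
    ... | inj₁ (h , n≡2h)   = inj₂ (h , cong suc n≡2h)
    ... | inj₂ (h , n≡2h+1) = inj₁ (suc h , trans (cong suc n≡2h+1) (cong suc (sym (ℕP.+-suc h h))))
  ... | inj₂ odd          = odd
  ... | inj₁ (h , p≡h+h) = ⊥-elim (Prime.notComposite pp (composite-≢ 2 2≢p (ℕD.divides h (trans p≡h+h (sym h*2≡h+h)))))
    where
    instance _ = prime⇒nonZero pp
    h*2≡h+h : h ℕ.* 2 ≡ h ℕ.+ h
    h*2≡h+h = trans (ℕP.*-comm h 2) (cong (h ℕ.+_) (ℕP.+-identityʳ h))

  m*2≡n⇒m/1≡n/2 : ∀ m n → m ℕ.* 2 ≡ n → + m / 1 ≡ + n / 2
  m*2≡n⇒m/1≡n/2 m n m*2≡n = toℚᵘ-injective (begin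
    toℚᵘ (+ m / 1)   ≈⟨ toℚᵘ-fromℚᵘ (mkℚᵘ (+ m) 0) ⟩
    mkℚᵘ (+ m) 0     ≈⟨ *≡* (trans (sym (pos-* m 2)) (trans (cong +_ m*2≡n) (sym (*-identityʳ (+ n))))) ⟩
    mkℚᵘ (+ n) 1     ≈⟨ toℚᵘ-fromℚᵘ (mkℚᵘ (+ n) 1) ⟨
    toℚᵘ (+ n / 2)   ∎)
    where open ℚᵘ.≃-Reasoning

  private
    cross-multiplied : ∀ m d A B → + 2 * (1ℤ + + d) * + m ≡ + 2 * A + + 3 * (1ℤ + + d) + B →
      + m * + (suc d ℕ.* 2 ℕ.* (2 ℕ.* suc d)) ≡ ((A * + 2 + + 3 * + suc d) * (+ 2 * + suc d) + B * (+ suc d * + 2)) * 1ℤ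
    cross-multiplied m d A B cleared = begin
      + m * + (suc d ℕ.* 2 ℕ.* (2 ℕ.* suc d))   ≡⟨ cong (+ m *_) denominators ⟩
      + m * (1+d * + 2 * (+ 2 * 1+d))           ≡⟨ regroupˡ (+ m) 1+d ⟩
      (+ 2 * 1+d * + m) * (+ 2 * 1+d)           ≡⟨ cong (_* (+ 2 * 1+d)) cleared ⟩
      (+ 2 * A + + 3 * 1+d + B) * (+ 2 * 1+d)   ≡⟨ regroupʳ A B 1+d ⟩
      ((A * + 2 + + 3 * 1+d) * (+ 2 * 1+d) + B * (1+d * + 2)) * 1ℤ
        ≡⟨ cong (λ z → ((A * + 2 + + 3 * z) * (+ 2 * z) + B * (z * + 2)) * 1ℤ) +[1+d]≡ ⟨
      ((A * + 2 + + 3 * + suc d) * (+ 2 * + suc d) + B * (+ suc d * + 2)) * 1ℤ ∎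
      where
      open ≡-Reasoning
      1+d : ℤ
      1+d = 1ℤ + + d
      +[1+d]≡ : + suc d ≡ 1+d
      +[1+d]≡ = pos-+ 1 d
      denominators : + (suc d ℕ.* 2 ℕ.* (2 ℕ.* suc d)) ≡ 1+d * + 2 * (+ 2 * 1+d)
      denominators = trans (pos-* (suc d ℕ.* 2) (2 ℕ.* suc d)) (cong₂ _*_
        (trans (pos-* (suc d) 2) (cong (_* + 2) +[1+d]≡)) (trans (pos-* 2 (suc d)) (cong (+ 2 *_) +[1+d]≡)))
      regroupˡ : ∀ m D → m * (D * + 2 * (+ 2 * D)) ≡ (+ 2 * D * m) * (+ 2 * D)
      regroupˡ m D = solve (m ∷ D ∷ [])
      regroupʳ : ∀ A B D → (+ 2 * A + + 3 * D + B) * (+ 2 * D) ≡ ((A * + 2 + + 3 * D) * (+ 2 * D) + B * (D * + 2)) * 1ℤ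
      regroupʳ A B D = solve (A ∷ B ∷ D ∷ [])

  m/1≡A/[1+d]+3/2+B/[2*[1+d]] : ∀ m d A B →
    + 2 * (1ℤ + + d) * + m ≡ + 2 * A + + 3 * (1ℤ + + d) + B →
    + m / 1 ≡ A / suc d +ℚ + 3 / 2 +ℚ B / (2 ℕ.* suc d)
  m/1≡A/[1+d]+3/2+B/[2*[1+d]] m d A B cleared = toℚᵘ-injective (begin
    toℚᵘ (+ m / 1)
      ≈⟨ toℚᵘ-fromℚᵘ (mkℚᵘ (+ m) 0) ⟩
    mkℚᵘ (+ m) 0
      ≈⟨ *≡* (cross-multiplied m d A B cleared) ⟩
    mkℚᵘ A d +ᵘ mkℚᵘ (+ 3) 1 +ᵘ mkℚᵘ B (ℕ.pred (2 ℕ.* suc d))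
      ≈⟨ ℚᵘ.+-cong (ℚᵘ.+-cong (toℚᵘ-fromℚᵘ (mkℚᵘ A d)) (toℚᵘ-fromℚᵘ (mkℚᵘ (+ 3) 1))) (toℚᵘ-fromℚᵘ (mkℚᵘ B _)) ⟨
    toℚᵘ (A / suc d) +ᵘ toℚᵘ (+ 3 / 2) +ᵘ toℚᵘ (B / (2 ℕ.* suc d))
      ≈⟨ ℚᵘ.+-cong (toℚᵘ-homo-+ (A / suc d) (+ 3 / 2)) ℚᵘ.≃-refl ⟨
    toℚᵘ (A / suc d +ℚ + 3 / 2) +ᵘ toℚᵘ (B / (2 ℕ.* suc d))
      ≈⟨ toℚᵘ-homo-+ (A / suc d +ℚ + 3 / 2) (B / (2 ℕ.* suc d)) ⟨
    toℚᵘ (A / suc d +ℚ + 3 / 2 +ℚ B / (2 ℕ.* suc d))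
      ∎)
    where open ℚᵘ.≃-Reasoning

  module OddPrime {p h : ℕ} (pp : Prime p) (p≡2h+1 : p ≡ suc (h ℕ.+ h)) where

    instance
      p-nonZero : ℕ.NonZero p
      p-nonZero = prime⇒nonZero pp

    p≢2 : p ≢ 2
    p≢2 p≡2 = h+h≢1 h (ℕP.suc-injective (trans (sym p≡2h+1) p≡2))
      where
      h+h≢1 : ∀ h → h ℕ.+ h ≢ 1
      h+h≢1 (suc h) eq = ℕP.1+n≢0 (trans (sym (ℕP.+-suc h h)) (ℕP.suc-injective eq))

    h<p : h ℕ.< p
    h<p = subst (h ℕ.<_) (sym p≡2h+1) (s≤s (ℕP.m≤m+n h h))

    +p≡1+2h : + p ≡ 1ℤ + (+ h + + h)
    +p≡1+2h = trans (cong +_ p≡2h+1) (trans (pos-+ 1 (h ℕ.+ h)) (cong (λ z → 1ℤ + z) (pos-+ h h)))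

    half : ℤ
    half = + suc h

    2*half≈1 : + 2 * half ≈ 1ℤ [ p ]
    2*half≈1 = subst (+ 2 * half ≈ 1ℤ [_]) (sym p≡2h+1) (2*[1+m]≈1 h)

    p∤half : ¬ + p ∣ half
    p∤half p∣half = ∤-nonzero-residue (s≤s z≤n) (1<p pp) (∣-resp-≈ 2*half≈1 (∣n⇒∣m*n (+ 2) p∣half))

    opaque
      root : ℤ → ℕ
      root c = search (λ z → + z * + z ≈? c [ p ]) p

      root-sound : ∀ {c} → SquareMod p c → root c ℕ.< p × + root c * + root c ≈ c [ p ]
      root-sound {c} sq = search-sound (λ z → + z * + z ≈? c [ p ]) p (SquareMod-residue sq)

    root-positive : ∀ {c} → ¬ + p ∣ c → SquareMod p c → 0 ℕ.< root c
    root-positive {c} p∤c sq with root c | root-sound sq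
    ... | zero  | _ , 0≈c = ⊥-elim (p∤c (∣-resp-≈ 0≈c ∣0))
    ... | suc _ | _       = s≤s z≤n

    opaque
      fold : ℕ → ℕ
      fold z with z ℕP.≤? h
      ... | yes _ = z
      ... | no _  = p ℕ.∸ z

      fold-range : ∀ z → 0 ℕ.< z → z ℕ.< p → 0 ℕ.< fold z × fold z ℕ.≤ h
      fold-range z 0<z z<p with z ℕP.≤? h
      ... | yes z≤h = 0<z , z≤h
      ... | no z≰h  = ℕP.m<n⇒0<n∸m z<p , subst (p ℕ.∸ z ℕ.≤_) p∸[1+h]≡h (ℕP.∸-monoʳ-≤ p (ℕP.≰⇒> z≰h))
        where
        p∸[1+h]≡h : p ℕ.∸ suc h ≡ h
        p∸[1+h]≡h = trans (cong (ℕ._∸ suc h) p≡2h+1) (ℕP.m+n∸m≡n h h)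

      fold-square : ∀ z → z ℕ.≤ p → + fold z * + fold z ≈ + z * + z [ p ]
      fold-square z z≤p with z ℕP.≤? h
      ... | yes _ = ≈-refl
      ... | no _  = subst (λ w → w * w ≈ + z * + z [ p ]) (sym +[p∸z]≡)
                      (mk≈ (divides (+ p - + 2 * + z) (negated-square (+ p) (+ z))))
        where
        +[p∸z]≡ : + (p ℕ.∸ z) ≡ + p - + z
        +[p∸z]≡ = sym (trans (m-n≡m⊖n p z) (⊖-≥ z≤p))
        negated-square : ∀ P Z → (P - Z) * (P - Z) - Z * Z ≡ (P - + 2 * Z) * P
        negated-square P Z = solve (P ∷ Z ∷ [])

    UnitTimesSquare : ℤ → ℕ → Set
    UnitTimesSquare e r = ¬ + p ∣ + r × SquareMod p (+ r * e)

    unitTimesSquare? : ∀ e → Decidable (UnitTimesSquare e)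
    unitTimesSquare? e r = ¬? (+ p ∣? + r) ×-dec squareMod? p (+ r * e)

    module _ {e : ℤ} (p∤e : ¬ + p ∣ e) where

      private
        ē : ℤ
        ē = proj₁ (inverse pp e p∤e)

        eē≈1 : e * ē ≈ 1ℤ [ p ]
        eē≈1 = proj₂ (inverse pp e p∤e)

        fromIndex : ℕ → ℕ
        fromIndex x = residue p (+ suc x * + suc x * ē)

        rootIndex : ℕ → ℕ
        rootIndex r = fold (root (+ r * e)) ℕ.∸ 1

        root-range : ∀ {r} → r ℕ.< p → UnitTimesSquare e r → 0 ℕ.< fold (root (+ r * e)) × fold (root (+ r * e)) ℕ.≤ h
        root-range _ (p∤r , sq) = fold-range _ (root-positive (∤*∤⇒∤* pp p∤r p∤e) sq) (proj₁ (root-sound sq))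

        rootIndex-maps : ∀ r → r ℕ.< p → UnitTimesSquare e r → rootIndex r ℕ.< h × ⊤
        rootIndex-maps r r<p A = let (0<z , z≤h) = root-range r<p A in pred-< 0<z z≤h , tt
          where
          pred-< : ∀ {z} → 0 ℕ.< z → z ℕ.≤ h → z ℕ.∸ 1 ℕ.< h
          pred-< {suc z} _ z<h = z<h

        rootIndex-injective : ∀ i j → i ℕ.< p → j ℕ.< p → UnitTimesSquare e i → UnitTimesSquare e j →
          rootIndex i ≡ rootIndex j → i ≡ j
        rootIndex-injective i j i<p j<p Ai Aj eq = residues-≈⇒≡ i<p j<p (≈-cancel-unit pp p∤e (begin
          + i * e                                      ≈⟨ proj₂ (root-sound (proj₂ Ai)) ⟨
          + root (+ i * e) * + root (+ i * e)          ≈⟨ fold-square _ (ℕP.<⇒≤ (proj₁ (root-sound (proj₂ Ai)))) ⟨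
          + fold (root (+ i * e)) * + fold (root (+ i * e))
            ≡⟨ cong (λ w → + w * + w) (ℕP.∸-cancelʳ-≡ (proj₁ (root-range i<p Ai)) (proj₁ (root-range j<p Aj)) eq) ⟩
          + fold (root (+ j * e)) * + fold (root (+ j * e))
            ≈⟨ fold-square _ (ℕP.<⇒≤ (proj₁ (root-sound (proj₂ Aj)))) ⟩
          + root (+ j * e) * + root (+ j * e)          ≈⟨ proj₂ (root-sound (proj₂ Aj)) ⟩
          + j * e                                      ∎))
          where open ≈-Reasoning p

        fromIndex-≈ : ∀ x → + fromIndex x * e ≈ + suc x * + suc x [ p ]
        fromIndex-≈ x = begin
          + fromIndex x * e                ≈⟨ ≈-*ʳ e (residue-≈ p _) ⟩
          + suc x * + suc x * ē * e        ≡⟨ reassociate (+ suc x) ē e ⟩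
          + suc x * + suc x * (e * ē)      ≈⟨ ≈-*ˡ (+ suc x * + suc x) eē≈1 ⟩
          + suc x * + suc x * 1ℤ           ≡⟨ *-identityʳ _ ⟩
          + suc x * + suc x                ∎
          where
          open ≈-Reasoning p
          reassociate : ∀ X ē e → X * X * ē * e ≡ X * X * (e * ē)
          reassociate X ē e = solve (X ∷ ē ∷ e ∷ [])

        1+x<p : ∀ {x} → x ℕ.< h → suc x ℕ.< p
        1+x<p x<h = ℕP.≤-<-trans x<h h<p

        fromIndex-maps : ∀ x → x ℕ.< h → ⊤ → fromIndex x ℕ.< p × UnitTimesSquare e (fromIndex x)
        fromIndex-maps x x<h _ = residue-< p _ , p∤fromIndex , (+ suc x , ≈-sym (fromIndex-≈ x))
          where
          p∤fromIndex : ¬ + p ∣ + fromIndex x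
          p∤fromIndex p∣r = ∤-nonzero-residue (s≤s z≤n) (1+x<p x<h)
            (∣x*x⇒∣x pp (∣-resp-≈ (fromIndex-≈ x) (∣m⇒∣m*n e p∣r)))

        fromIndex-injective : ∀ i j → i ℕ.< h → j ℕ.< h → ⊤ → ⊤ → fromIndex i ≡ fromIndex j → i ≡ j
        fromIndex-injective i j i<h j<h _ _ eq with square-≈⇒≈± pp (begin
          + suc i * + suc i   ≈⟨ fromIndex-≈ i ⟨
          + fromIndex i * e   ≡⟨ cong (λ w → + w * e) eq ⟩
          + fromIndex j * e   ≈⟨ fromIndex-≈ j ⟩
          + suc j * + suc j   ∎)
          where open ≈-Reasoning p
        ... | inj₁ i≈j  = ℕP.suc-injective (residues-≈⇒≡ (1+x<p i<h) (1+x<p j<h) i≈j)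
        ... | inj₂ i≈-j = ⊥-elim (∤-nonzero-residue (s≤s z≤n) i+j<p (un≈ i≈-j ∣-by trans (sub-neg (+ suc i) (+ suc j)) (sym (pos-+ (suc i) (suc j)))))
          where
          i+j<p : suc i ℕ.+ suc j ℕ.< p
          i+j<p = subst (suc i ℕ.+ suc j ℕ.<_) (sym p≡2h+1) (s≤s (ℕP.+-mono-≤ i<h j<h))
          sub-neg : ∀ a b → a - - b ≡ a + b
          sub-neg a b = solve (a ∷ b ∷ [])

      count-unitTimesSquare : count (unitTimesSquare? e) p ≡ h
      count-unitTimesSquare = trans
        (count-bijection (unitTimesSquare? e) (λ _ → yes tt) p h rootIndex fromIndex rootIndex-maps rootIndex-injective fromIndex-maps fromIndex-injective)
        (count-all (λ _ → yes tt) h (λ _ _ → tt))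

    module Discriminant {a : ℤ} (¬sq[a] : ¬ SquareMod p a) where

      D : ℤ
      D = + 4 * a

      p∤a : ¬ + p ∣ a
      p∤a p∣a = ¬sq[a] (0ℤ , mk≈ (∣m⇒∣-m p∣a ∣-by neg-as-difference a))
        where
        neg-as-difference : ∀ a → - a ≡ 0ℤ * 0ℤ - a
        neg-as-difference a = solve (a ∷ [])

      p∤D : ¬ + p ∣ D
      p∤D = ∤*∤⇒∤* pp (λ p∣4 → odd-prime∤2 pp p≢2 (∣x*x⇒∣x pp p∣4)) p∤a

      ¬sq[D] : ¬ SquareMod p D
      ¬sq[D] (x , xx≈D) = ¬sq[a] (x * half , (begin
        x * half * (x * half)             ≡⟨ regroup x half ⟩
        x * x * (half * half)             ≈⟨ ≈-*ʳ (half * half) xx≈D ⟩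
        + 4 * a * (half * half)           ≡⟨ regroup′ a half ⟩
        (+ 2 * half) * (+ 2 * half) * a   ≈⟨ ≈-*ʳ a (≈-* 2*half≈1 2*half≈1) ⟩
        1ℤ * 1ℤ * a                       ≡⟨ solve (a ∷ []) ⟩
        a                                 ∎))
        where
        open ≈-Reasoning p
        regroup : ∀ x i → x * i * (x * i) ≡ x * x * (i * i)
        regroup x i = solve (x ∷ i ∷ [])
        regroup′ : ∀ a i → + 4 * a * (i * i) ≡ (+ 2 * i) * (+ 2 * i) * a
        regroup′ a i = solve (a ∷ i ∷ [])

      IsUnit : ℕ → Set
      IsUnit w = ¬ + p ∣ + w

      isUnit? : Decidable IsUnit
      isUnit? w = ¬? (+ p ∣? + w)

      opaque
        partner : ℕ → ℕ
        partner w = search (λ v → + w * + v ≈? D [ p ]) p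

        partner-found : ∀ {w} → (∃ λ v → v ℕ.< p × + w * + v ≈ D [ p ]) → partner w ℕ.< p × + w * + partner w ≈ D [ p ]
        partner-found {w} = search-sound (λ v → + w * + v ≈? D [ p ]) p

      partner-sound : ∀ {w} → IsUnit w → partner w ℕ.< p × + w * + partner w ≈ D [ p ] × IsUnit (partner w)
      partner-sound {w} unit = let (v<p , wv≈D) = found in v<p , wv≈D , λ p∣v → p∤D (∣-resp-≈ wv≈D (∣n⇒∣m*n (+ w) p∣v))
        where
        w⁻¹ : ∃ λ b → + w * b ≈ 1ℤ [ p ]
        w⁻¹ = inverse pp (+ w) unit
        found : partner w ℕ.< p × + w * + partner w ≈ D [ p ]
        found = partner-found (residue p (D * proj₁ w⁻¹) , residue-< p _ , (begin
          + w * + residue p (D * proj₁ w⁻¹)   ≈⟨ ≈-*ˡ (+ w) (residue-≈ p _) ⟩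
          + w * (D * proj₁ w⁻¹)               ≡⟨ swap (+ w) D (proj₁ w⁻¹) ⟩
          D * (+ w * proj₁ w⁻¹)               ≈⟨ ≈-*ˡ D (proj₂ w⁻¹) ⟩
          D * 1ℤ                              ≡⟨ *-identityʳ D ⟩
          D                                   ∎))
          where
          open ≈-Reasoning p
          swap : ∀ w D b → w * (D * b) ≡ D * (w * b)
          swap w D b = solve (w ∷ D ∷ b ∷ [])

      partner-unique : ∀ {w v} → IsUnit w → v ℕ.< p → + w * + v ≈ D [ p ] → partner w ≡ v
      partner-unique {w} {v} unit v<p wv≈D = residues-≈⇒≡ (proj₁ (partner-sound unit)) v<p
        (≈-cancel-unit pp unit (begin
          + partner w * + w   ≡⟨ *-comm (+ partner w) (+ w) ⟩
          + w * + partner w   ≈⟨ proj₁ (proj₂ (partner-sound unit)) ⟩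
          D                   ≈⟨ wv≈D ⟨
          + w * + v           ≡⟨ *-comm (+ w) (+ v) ⟩
          + v * + w           ∎))
        where open ≈-Reasoning p

      partner-involutive : ∀ {w} → w ℕ.< p → IsUnit w → partner (partner w) ≡ w
      partner-involutive {w} w<p unit = partner-unique (proj₂ (proj₂ (partner-sound unit))) w<p
        (≈-trans (≈-reflexive (*-comm (+ partner w) (+ w))) (proj₁ (proj₂ (partner-sound unit))))

      partner-≢ : ∀ {w} → IsUnit w → partner w ≢ w
      partner-≢ {w} unit pw≡w = ¬sq[D] (+ w , subst (λ v → + w * + v ≈ D [ p ]) pw≡w (proj₁ (proj₂ (partner-sound unit))))

      count-units : count isUnit? p ≡ h ℕ.+ h
      count-units = subst (λ n → count isUnit? n ≡ h ℕ.+ h) (sym p≡2h+1) (begin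
        count isUnit? (1 ℕ.+ (h ℕ.+ h))                                ≡⟨ count-+ isUnit? 1 (h ℕ.+ h) ⟩
        indicator (isUnit? 0) ℕ.+ count (λ k → isUnit? (suc k)) (h ℕ.+ h)
          ≡⟨ cong₂ ℕ._+_ (indicator-no (isUnit? 0) (λ unit → unit ∣0)) (count-all _ (h ℕ.+ h) (λ k k<2h →
               ∤-nonzero-residue (s≤s z≤n) (subst (suc k ℕ.<_) (sym p≡2h+1) (s≤s k<2h)))) ⟩
        h ℕ.+ h                                                          ∎)
        where open ≡-Reasoning

      Lower Upper : ℕ → Set
      Lower w = IsUnit w × w ℕ.< partner w
      Upper w = IsUnit w × partner w ℕ.< w

      lower? : Decidable Lower
      lower? w = isUnit? w ×-dec (w ℕP.<? partner w)

      upper? : Decidable Upper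
      upper? w = isUnit? w ×-dec (partner w ℕP.<? w)

      count-lower : count lower? p ≡ h
      count-lower = m+m≡n+n⇒m≡n (begin
        count lower? p ℕ.+ count lower? p   ≡⟨ cong (count lower? p ℕ.+_) lower≡upper ⟩
        count lower? p ℕ.+ count upper? p   ≡⟨ count-disjoint-union isUnit? lower? upper? p lower-or-upper
                                                  (λ _ _ → proj₁) (λ _ _ → proj₁) (λ _ _ (_ , w<pw) (_ , pw<w) → ℕP.<-asym w<pw pw<w) ⟨
        count isUnit? p                     ≡⟨ count-units ⟩
        h ℕ.+ h                             ∎)
        where
        open ≡-Reasoning
        lower-or-upper : ∀ w → w ℕ.< p → IsUnit w → Lower w ⊎ Upper w
        lower-or-upper w _ unit with ℕP.<-cmp w (partner w)
        ... | tri< w<pw _ _ = inj₁ (unit , w<pw)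
        ... | tri≈ _ w≡pw _ = ⊥-elim (partner-≢ unit (sym w≡pw))
        ... | tri> _ _ pw<w = inj₂ (unit , pw<w)
        partner-injective : ∀ i j → i ℕ.< p → j ℕ.< p → IsUnit i → IsUnit j → partner i ≡ partner j → i ≡ j
        partner-injective i j i<p j<p ui uj eq =
          trans (sym (partner-involutive i<p ui)) (trans (cong partner eq) (partner-involutive j<p uj))
        lower≡upper : count lower? p ≡ count upper? p
        lower≡upper = count-bijection lower? upper? p p partner partner
          (λ w w<p (unit , w<pw) → proj₁ (partner-sound unit) , proj₂ (proj₂ (partner-sound unit)) ,
                                   subst (ℕ._< partner w) (sym (partner-involutive w<p unit)) w<pw)
          (λ i j i<p j<p li lj → partner-injective i j i<p j<p (proj₁ li) (proj₁ lj))
          (λ w w<p (unit , pw<w) → proj₁ (partner-sound unit) , proj₂ (proj₂ (partner-sound unit)) ,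
                                   subst (partner w ℕ.<_) (sym (partner-involutive w<p unit)) pw<w)
          (λ i j i<p j<p ui uj → partner-injective i j i<p j<p (proj₁ ui) (proj₁ uj))
        m+m≡n+n⇒m≡n : ∀ {m n} → m ℕ.+ m ≡ n ℕ.+ n → m ≡ n
        m+m≡n+n⇒m≡n {m} {n} eq with ℕP.<-cmp m n
        ... | tri< m<n _ _ = ⊥-elim (ℕP.<-irrefl eq (ℕP.+-mono-< m<n m<n))
        ... | tri≈ _ m≡n _ = m≡n
        ... | tri> _ _ n<m = ⊥-elim (ℕP.<-irrefl (sym eq) (ℕP.+-mono-< n<m n<m))

      DiscriminantSquare : ℕ → Set
      DiscriminantSquare s = SquareMod p (+ s * + s - D)

      discriminantSquare? : Decidable DiscriminantSquare
      discriminantSquare? s = squareMod? p (+ s * + s - D)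

      midpoint : ℕ → ℕ
      midpoint w = residue p ((+ w + + partner w) * half)

      midpoint-maps : ∀ w → w ℕ.< p → Lower w → midpoint w ℕ.< p × DiscriminantSquare (midpoint w)
      midpoint-maps w _ (unit , _) = residue-< p _ , (+ partner w - + w) * half , ≈-sym (begin
        + midpoint w * + midpoint w - D
          ≈⟨ ≈-+ʳ (- D) (≈-* (residue-≈ p _) (residue-≈ p _)) ⟩
        (W + W′) * half * ((W + W′) * half) - D
          ≡⟨ difference-of-squares W W′ half D ⟩
        (W′ - W) * half * ((W′ - W) * half) + (+ 2 * half) * (+ 2 * half) * (W * W′) - D
          ≈⟨ ≈-+ʳ (- D) (≈-+ˡ ((W′ - W) * half * ((W′ - W) * half)) (≈-* (≈-* 2*half≈1 2*half≈1) (proj₁ (proj₂ (partner-sound unit))))) ⟩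
        (W′ - W) * half * ((W′ - W) * half) + 1ℤ * 1ℤ * D - D
          ≡⟨ cancel-D ((W′ - W) * half * ((W′ - W) * half)) D ⟩
        (W′ - W) * half * ((W′ - W) * half)
          ∎)
        where
        open ≈-Reasoning p
        W W′ : ℤ
        W = + w
        W′ = + partner w
        difference-of-squares : ∀ w w′ i D → (w + w′) * i * ((w + w′) * i) - D
          ≡ (w′ - w) * i * ((w′ - w) * i) + (+ 2 * i) * (+ 2 * i) * (w * w′) - D
        difference-of-squares w w′ i D = solve (w ∷ w′ ∷ i ∷ D ∷ [])
        cancel-D : ∀ x D → x + 1ℤ * 1ℤ * D - D ≡ x
        cancel-D x D = solve (x ∷ D ∷ [])

      midpoint-injective : ∀ i j → i ℕ.< p → j ℕ.< p → Lower i → Lower j → midpoint i ≡ midpoint j → i ≡ j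
      midpoint-injective i j i<p j<p (unit-i , i<i′) (unit-j , j<j′) eq =
        Sum.[ (λ p∣i-j → residues-≈⇒≡ i<p j<p (mk≈ p∣i-j)) , (λ p∣ij-D → ⊥-elim (partners p∣ij-D)) ]′
          (∣*⇒∣⊎∣ pp (x - y) (x * y - D) (≈0⇒∣ key))
        where
        open ≈-Reasoning p
        x y x′ y′ : ℤ
        x = + i
        y = + j
        x′ = + partner i
        y′ = + partner j
        sums≈ : x + x′ ≈ y + y′ [ p ]
        sums≈ = ≈-cancel-unit pp p∤half (≈-trans (≈-sym (residue-≈ p _)) (≈-trans (≈-reflexive (cong +_ eq)) (residue-≈ p _)))
        expand : ∀ i j D → (i - j) * (i * j - D) ≡ i * j * (i - j) + j * D - i * D
        expand i j D = solve (i ∷ j ∷ D ∷ [])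
        regroup : ∀ i j i′ j′ → i * j * (i - j) + j * (i * i′) - i * (j * j′) ≡ i * j * (i + i′) - i * j * (j + j′)
        regroup i j i′ j′ = solve (i ∷ j ∷ i′ ∷ j′ ∷ [])
        key : (x - y) * (x * y - D) ≈ 0ℤ [ p ]
        key = begin
          (x - y) * (x * y - D)
            ≡⟨ expand x y D ⟩
          x * y * (x - y) + y * D - x * D
            ≈⟨ ≈-+ (≈-+ˡ (x * y * (x - y)) (≈-*ˡ y (proj₁ (proj₂ (partner-sound unit-i)))))
                   (≈-neg (≈-*ˡ x (proj₁ (proj₂ (partner-sound unit-j))))) ⟨
          x * y * (x - y) + y * (x * x′) - x * (y * y′)
            ≡⟨ regroup x y x′ y′ ⟩
          x * y * (x + x′) - x * y * (y + y′)
            ≈⟨ ≈-+ʳ (- (x * y * (y + y′))) (≈-*ˡ (x * y) sums≈) ⟩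
          x * y * (y + y′) - x * y * (y + y′)
            ≡⟨ +-inverseʳ (x * y * (y + y′)) ⟩
          0ℤ
            ∎
        partners : + p ∣ x * y - D → ⊥
        partners p∣ij-D = ℕP.<-asym i<i′ (subst₂ ℕ._<_ j≡i′ j′≡i j<j′)
          where
          j≡i′ : j ≡ partner i
          j≡i′ = sym (partner-unique unit-i j<p (mk≈ p∣ij-D))
          j′≡i : partner j ≡ i
          j′≡i = trans (cong partner j≡i′) (partner-involutive i<p unit-i)

      lower-of : ℕ → ℕ
      lower-of w = w ℕ.⊓ partner w

      lower-of-sound : ∀ {w} → w ℕ.< p → IsUnit w →
        lower-of w ℕ.< p × Lower (lower-of w) × + lower-of w + + partner (lower-of w) ≡ + w + + partner w
      lower-of-sound {w} w<p unit = Sum.[ keep , swap ]′ (ℕP.≤-total w (partner w))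
        where
        Sound : ℕ → Set
        Sound v = v ℕ.< p × Lower v × + v + + partner v ≡ + w + + partner w
        keep : w ℕ.≤ partner w → Sound (lower-of w)
        keep w≤w′ = subst Sound (sym (ℕP.m≤n⇒m⊓n≡m w≤w′))
          (w<p , (unit , ℕP.≤∧≢⇒< w≤w′ (λ w≡w′ → partner-≢ unit (sym w≡w′))) , refl)
        swap : partner w ℕ.≤ w → Sound (lower-of w)
        swap w′≤w = subst Sound (sym (ℕP.m≥n⇒m⊓n≡n w′≤w))
          ( proj₁ (partner-sound unit)
          , (proj₂ (proj₂ (partner-sound unit)) , subst (partner w ℕ.<_) (sym w″≡w) (ℕP.≤∧≢⇒< w′≤w (partner-≢ unit)))
          , trans (cong (λ v → + partner w + + v) w″≡w) (+-comm (+ partner w) (+ w)))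
          where
          w″≡w : partner (partner w) ≡ w
          w″≡w = partner-involutive w<p unit

      module Factor (s : ℕ) (sq : DiscriminantSquare s) where
        u factor cofactor : ℕ
        u = root (+ s * + s - D)
        factor = residue p (+ s - + u)
        cofactor = residue p (+ s + + u)

        factor*cofactor : + factor * + cofactor ≈ D [ p ]
        factor*cofactor = begin
          + factor * + cofactor       ≈⟨ ≈-* (residue-≈ p _) (residue-≈ p _) ⟩
          (S - U) * (S + U)           ≡⟨ difference-of-squares S U ⟩
          S * S - U * U               ≈⟨ ≈-+ˡ (S * S) (≈-neg (proj₂ (root-sound sq))) ⟩
          S * S - (S * S - D)         ≡⟨ cancel S D ⟩
          D                           ∎
          where
          open ≈-Reasoning p
          S U : ℤ
          S = + s
          U = + u
          difference-of-squares : ∀ s u → (s - u) * (s + u) ≡ s * s - u * u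
          difference-of-squares s u = solve (s ∷ u ∷ [])
          cancel : ∀ s D → s * s - (s * s - D) ≡ D
          cancel s D = solve (s ∷ D ∷ [])

        factor-unit : IsUnit factor
        factor-unit p∣f = p∤D (∣-resp-≈ factor*cofactor (∣m⇒∣m*n (+ cofactor) p∣f))

        factor+partner : + factor + + partner factor ≈ + 2 * + s [ p ]
        factor+partner = begin
          + factor + + partner factor  ≡⟨ cong (λ v → + factor + + v) (partner-unique factor-unit (residue-< p _) factor*cofactor) ⟩
          + factor + + cofactor        ≈⟨ ≈-+ (residue-≈ p _) (residue-≈ p _) ⟩
          (+ s - + u) + (+ s + + u)    ≡⟨ doubled (+ s) (+ u) ⟩
          + 2 * + s                    ∎
          where
          open ≈-Reasoning p
          doubled : ∀ s u → (s - u) + (s + u) ≡ + 2 * s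
          doubled s u = solve (s ∷ u ∷ [])

      lower-factor : ℕ → ℕ
      lower-factor s = lower-of (residue p (+ s - + root (+ s * + s - D)))

      lower-factor-sound : ∀ s → DiscriminantSquare s →
        lower-factor s ℕ.< p × Lower (lower-factor s) × + lower-factor s + + partner (lower-factor s) ≈ + 2 * + s [ p ]
      lower-factor-sound s sq = let (<p , lower , sum≡) = lower-of-sound (residue-< p _) factor-unit in
        <p , lower , ≈-trans (≈-reflexive sum≡) factor+partner
        where open Factor s sq

      count-discriminantSquare : count discriminantSquare? p ≡ h
      count-discriminantSquare = trans
        (count-bijection discriminantSquare? lower? p p lower-factor midpoint
          (λ s _ sq → let (<p , lower , _) = lower-factor-sound s sq in <p , lower)
          (λ i j i<p j<p sq-i sq-j eq → residues-≈⇒≡ i<p j<p (≈-cancel-unit pp (odd-prime∤2 pp p≢2) (begin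
            + i * + 2                                          ≡⟨ *-comm (+ i) (+ 2) ⟩
            + 2 * + i                                          ≈⟨ proj₂ (proj₂ (lower-factor-sound i sq-i)) ⟨
            + lower-factor i + + partner (lower-factor i)      ≡⟨ cong (λ g → + g + + partner g) eq ⟩
            + lower-factor j + + partner (lower-factor j)      ≈⟨ proj₂ (proj₂ (lower-factor-sound j sq-j)) ⟩
            + 2 * + j                                          ≡⟨ *-comm (+ 2) (+ j) ⟩
            + j * + 2                                          ∎)))
          midpoint-maps midpoint-injective)
        count-lower
        where open ≈-Reasoning p

    halfφ : ℕ → ℕ
    halfφ zero    = 0
    halfφ (suc T) = p ℕ.^ T ℕ.* h

    κ : ℕ → ℕ
    κ zero          = 1
    κ (suc zero)    = 1
    κ (suc (suc T)) = κ T ℕ.+ halfφ T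

    module Multiples {e : ℤ} (p∤e : ¬ + p ∣ e) where

      -- The coefficient m collects the factors p² picked up by the substitution j = p² i.
      quadratic : ℤ → ℕ → ℤ
      quadratic m j = + j * (m * + j + e)

      SquareAt : ℕ → ℤ → ℕ → Set
      SquareAt T m j = SquareMod (p ℕ.^ T) (quadratic m j)

      squareAt? : ∀ T m → Decidable (SquareAt T m)
      squareAt? T m j = squareMod? (p ℕ.^ T) {{ℕP.m^n≢0 p T}} (quadratic m j)

      countMultiples countUnits : ℤ → ℕ → ℕ
      countMultiples m T = count (λ j → (+ p ∣? + j) ×-dec squareAt? T m j) (p ℕ.^ T)
      countUnits     m T = count (λ j → ¬? (+ p ∣? + j) ×-dec squareAt? T m j) (p ℕ.^ T)

      private
        factor-p : ∀ m i → quadratic m (i ℕ.* p) ≡ + p * (+ i * (m * (+ i * + p) + e))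
        factor-p m i = trans (cong (λ z → z * (m * z + e)) (pos-* i p)) (regroup (+ i) (+ p) m e)
          where
          regroup : ∀ i P m e → i * P * (m * (i * P) + e) ≡ P * (i * (m * (i * P) + e))
          regroup i P m e = solve (i ∷ P ∷ m ∷ e ∷ [])

        factor-p² : ∀ m i → quadratic m (i ℕ.* p ℕ.* p) ≡ + p * (+ p * quadratic (m * (+ p * + p)) i)
        factor-p² m i = trans (cong (λ z → z * (m * z + e)) (trans (pos-* (i ℕ.* p) p) (cong (_* + p) (pos-* i p))))
                              (regroup (+ i) (+ p) m e)
          where
          regroup : ∀ i P m e → i * P * P * (m * (i * P * P) + e) ≡ P * (P * (i * (m * (P * P) * i + e)))
          regroup i P m e = solve (i ∷ P ∷ m ∷ e ∷ [])

        ¬squareAt-unit-multiple : ∀ m T i → ¬ + p ∣ + i → ¬ SquareAt (suc (suc T)) m (i ℕ.* p)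
        ¬squareAt-unit-multiple m T i p∤i sq = ¬SquareMod-p*unit pp {p ℕ.^ T} p∤unit
          (SquareMod-resp-≈ (≈-reflexive (factor-p m i)) sq)
          where
          p∤unit : ¬ + p ∣ + i * (m * (+ i * + p) + e)
          p∤unit = ∤*∤⇒∤* pp p∤i (λ p∣ → p∤e (∣m∣n⇒∣m-n p∣ (∣n⇒∣m*n (m * + i) ∣-refl) ∣-by drop-multiple m (+ i) (+ p) e))
            where
            drop-multiple : ∀ m i P e → (m * (i * P) + e) - m * i * P ≡ e
            drop-multiple m i P e = solve (m ∷ i ∷ P ∷ e ∷ [])

      countMultiples-0 : ∀ m → countMultiples m 0 ≡ 1
      countMultiples-0 m = indicator-yes ((+ p ∣? 0ℤ) ×-dec squareAt? 0 m 0) (∣0 , SquareMod-1 _)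

      countMultiples-1 : ∀ m → countMultiples m 1 ≡ 1
      countMultiples-1 m = begin
        count (λ j → (+ p ∣? + j) ×-dec squareAt? 1 m j) (p ℕ.* 1)  ≡⟨ cong (count _) (ℕP.*-comm p 1) ⟩
        count (λ j → (+ p ∣? + j) ×-dec squareAt? 1 m j) (1 ℕ.* p)  ≡⟨ count-multiples p (squareAt? 1 m) 1 ⟩
        indicator (squareAt? 1 m 0)                                 ≡⟨ indicator-yes (squareAt? 1 m 0) (0ℤ , ≈-refl) ⟩
        1                                                           ∎
        where open ≡-Reasoning

      countUnits-0 : ∀ m → countUnits m 0 ≡ 0
      countUnits-0 m = indicator-no (¬? (+ p ∣? 0ℤ) ×-dec squareAt? 0 m 0) (λ (p∤0 , _) → p∤0 ∣0)

      countMultiples-step : ∀ m T →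
        countMultiples m (suc (suc T)) ≡ countMultiples (m * (+ p * + p)) T ℕ.+ countUnits (m * (+ p * + p)) T
      countMultiples-step m T = begin
        count (λ j → (+ p ∣? + j) ×-dec squareAt? (2 ℕ.+ T) m j) (p ℕ.* (p ℕ.* p^T))
          ≡⟨ cong (count _) (ℕP.*-comm p (p ℕ.* p^T)) ⟩
        count (λ j → (+ p ∣? + j) ×-dec squareAt? (2 ℕ.+ T) m j) (p ℕ.* p^T ℕ.* p)
          ≡⟨ count-multiples p (squareAt? (2 ℕ.+ T) m) (p ℕ.* p^T) ⟩
        count (λ i → squareAt? (2 ℕ.+ T) m (i ℕ.* p)) (p ℕ.* p^T)
          ≡⟨ count-split (λ i → + p ∣? + i) (λ i → squareAt? (2 ℕ.+ T) m (i ℕ.* p)) (p ℕ.* p^T) ⟩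
        count (λ i → (+ p ∣? + i) ×-dec squareAt? (2 ℕ.+ T) m (i ℕ.* p)) (p ℕ.* p^T)
          ℕ.+ count (λ i → ¬? (+ p ∣? + i) ×-dec squareAt? (2 ℕ.+ T) m (i ℕ.* p)) (p ℕ.* p^T)
          ≡⟨ cong₂ ℕ._+_ p∣i (count-none _ (p ℕ.* p^T) (λ i _ (p∤i , sq) → ¬squareAt-unit-multiple m T i p∤i sq)) ⟩
        countMultiples m′ T ℕ.+ countUnits m′ T ℕ.+ 0
          ≡⟨ ℕP.+-identityʳ _ ⟩
        countMultiples m′ T ℕ.+ countUnits m′ T
          ∎
        where
        open ≡-Reasoning
        p^T : ℕ
        p^T = p ℕ.^ T
        m′ : ℤ
        m′ = m * (+ p * + p)
        p∣i : count (λ i → (+ p ∣? + i) ×-dec squareAt? (2 ℕ.+ T) m (i ℕ.* p)) (p ℕ.* p^T)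
            ≡ countMultiples m′ T ℕ.+ countUnits m′ T
        p∣i = begin
          count (λ i → (+ p ∣? + i) ×-dec squareAt? (2 ℕ.+ T) m (i ℕ.* p)) (p ℕ.* p^T)
            ≡⟨ cong (count _) (ℕP.*-comm p p^T) ⟩
          count (λ i → (+ p ∣? + i) ×-dec squareAt? (2 ℕ.+ T) m (i ℕ.* p)) (p^T ℕ.* p)
            ≡⟨ count-multiples p (λ i → squareAt? (2 ℕ.+ T) m (i ℕ.* p)) p^T ⟩
          count (λ i → squareAt? (2 ℕ.+ T) m (i ℕ.* p ℕ.* p)) p^T
            ≡⟨ count-cong _ (squareAt? T m′) p^T
                 (λ i _ sq → to (SquareMod-p²-cancel pp) (SquareMod-resp-≈ (≈-reflexive (factor-p² m i)) sq))
                 (λ i _ sq → SquareMod-resp-≈ (≈-reflexive (sym (factor-p² m i))) (from (SquareMod-p²-cancel pp) sq)) ⟩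
          count (squareAt? T m′) p^T
            ≡⟨ count-split (λ i → + p ∣? + i) (squareAt? T m′) p^T ⟩
          countMultiples m′ T ℕ.+ countUnits m′ T
            ∎
          where open Equivalence

      private
        quadratic≈ : ∀ {m} j → + p ∣ m → quadratic m j ≈ + j * e [ p ]
        quadratic≈ {m} j p∣m = mk≈ (∣n⇒∣m*n (+ j * + j) p∣m ∣-by drop-linear (+ j) m e)
          where
          drop-linear : ∀ j m e → j * j * m ≡ j * (m * j + e) - j * e
          drop-linear j m e = solve (j ∷ m ∷ e ∷ [])

        unitTimesSquare-respectsMod : RespectsMod p (UnitTimesSquare e)
        unitTimesSquare-respectsMod j≈k (p∤j , sq) = ∤-resp-≈ j≈k p∤j , SquareMod-resp-≈ (≈-*ʳ e j≈k) sq

      countUnits-step : ∀ m T → + p ∣ m → countUnits m (suc T) ≡ p ℕ.^ T ℕ.* h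
      countUnits-step m T p∣m = begin
        countUnits m (suc T)
          ≡⟨ count-cong _ (unitTimesSquare? e) (p ℕ.^ suc T)
               (λ j _ (p∤j , sq) → p∤j , SquareMod-resp-≈ (quadratic≈ j p∣m) (SquareMod-weaken p∣p^[1+T] sq))
               (λ j _ (p∤j , sq) → p∤j , SquareMod-lift pp p≢2 (∤-resp-≈ (≈-sym (quadratic≈ j p∣m)) (∤*∤⇒∤* pp p∤j p∤e))
                                            (SquareMod-resp-≈ (≈-sym (quadratic≈ j p∣m)) sq) T) ⟩
        count (unitTimesSquare? e) (p ℕ.* p ℕ.^ T)
          ≡⟨ cong (count (unitTimesSquare? e)) (ℕP.*-comm p (p ℕ.^ T)) ⟩
        count (unitTimesSquare? e) (p ℕ.^ T ℕ.* p)
          ≡⟨ count-periodic (unitTimesSquare? e) p (p ℕ.^ T) (respectsMod⇒periodic unitTimesSquare-respectsMod) ⟩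
        p ℕ.^ T ℕ.* count (unitTimesSquare? e) p
          ≡⟨ cong (p ℕ.^ T ℕ.*_) (count-unitTimesSquare p∤e) ⟩
        p ℕ.^ T ℕ.* h
          ∎
        where
        open ≡-Reasoning
        p∣p^[1+T] : + p ∣ + (p ℕ.^ suc T)
        p∣p^[1+T] = ∣ᵤ⇒∣ (ℕD.m∣m*n (p ℕ.^ T))

      countMultiples≡κ : ∀ T m → countMultiples m T ≡ κ T
      countMultiples≡κ zero          m = countMultiples-0 m
      countMultiples≡κ (suc zero)    m = countMultiples-1 m
      countMultiples≡κ (suc (suc T)) m =
        trans (countMultiples-step m T) (cong₂ ℕ._+_ (countMultiples≡κ T (m * (+ p * + p))) (countUnits≡halfφ T))
        where
        countUnits≡halfφ : ∀ T → countUnits (m * (+ p * + p)) T ≡ halfφ T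
        countUnits≡halfφ zero    = countUnits-0 (m * (+ p * + p))
        countUnits≡halfφ (suc T) = countUnits-step (m * (+ p * + p)) T (∣n⇒∣m*n m (∣m⇒∣m*n (+ p) ∣-refl))

    private
      H P : ℤ
      H = + h
      P = 1ℤ + (H + H)

      κℤ powℤ : ℕ → ℤ
      κℤ t = + κ (suc t)
      powℤ t = + (p ℕ.^ t)

      -1^ : ℕ → ℤ
      -1^ t = -1ℤ ^ t

      -1^[2+t] : ∀ t → -1^ (suc (suc t)) ≡ -1^ t
      -1^[2+t] t = trans (-1*i≡-i (-1ℤ * -1^ t)) (trans (cong -_ (-1*i≡-i (-1^ t))) (neg-involutive (-1^ t)))

      -- Stated with p = 1 + 2h, so that each step is a ring identity.
      κ-closed-form′ : ∀ t → + 2 * (1ℤ + P) * (κℤ t + κℤ t) ≡ + 2 * powℤ t + + 3 * (1ℤ + P) + -1^ t * (H + H)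
      κ-closed-form′ zero = base H
        where
        base : ∀ H → + 2 * (1ℤ + (1ℤ + (H + H))) * (+ 1 + + 1) ≡ + 2 * + 1 + + 3 * (1ℤ + (1ℤ + (H + H))) + 1ℤ * (H + H)
        base H = solve (H ∷ [])
      κ-closed-form′ (suc zero) = begin
        + 2 * (1ℤ + P) * (+ 1 + + 1)                      ≡⟨ base H ⟩
        + 2 * P + + 3 * (1ℤ + P) + -1ℤ * 1ℤ * (H + H)     ≡⟨ cong (λ z → + 2 * z + + 3 * (1ℤ + P) + -1ℤ * 1ℤ * (H + H)) P≡powℤ1 ⟩
        + 2 * powℤ 1 + + 3 * (1ℤ + P) + -1^ 1 * (H + H)      ∎
        where
        open ≡-Reasoning
        base : ∀ H → + 2 * (1ℤ + (1ℤ + (H + H))) * (+ 1 + + 1)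
                   ≡ + 2 * (1ℤ + (H + H)) + + 3 * (1ℤ + (1ℤ + (H + H))) + -1ℤ * 1ℤ * (H + H)
        base H = solve (H ∷ [])
        P≡powℤ1 : P ≡ powℤ 1
        P≡powℤ1 = trans (sym +p≡1+2h) (cong +_ (sym (ℕP.*-identityʳ p)))
      κ-closed-form′ (suc (suc t)) = begin
        + 2 * (1ℤ + P) * (κℤ (2 ℕ.+ t) + κℤ (2 ℕ.+ t))
          ≡⟨ cong (λ z → + 2 * (1ℤ + P) * (z + z)) κℤ[2+t]≡ ⟩
        + 2 * (1ℤ + P) * ((κℤ t + powℤ t * H) + (κℤ t + powℤ t * H))
          ≡⟨ split (κℤ t) (powℤ t) H ⟩
        + 2 * (1ℤ + P) * (κℤ t + κℤ t) + + 4 * (1ℤ + P) * powℤ t * H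
          ≡⟨ cong (_+ + 4 * (1ℤ + P) * powℤ t * H) (κ-closed-form′ t) ⟩
        + 2 * powℤ t + + 3 * (1ℤ + P) + -1^ t * (H + H) + + 4 * (1ℤ + P) * powℤ t * H
          ≡⟨ merge (powℤ t) (-1^ t) H ⟩
        + 2 * (P * (P * powℤ t)) + + 3 * (1ℤ + P) + -1^ t * (H + H)
          ≡⟨ cong₂ (λ x s → + 2 * x + + 3 * (1ℤ + P) + s * (H + H)) powℤ[2+t]≡ (sym (-1^[2+t] t)) ⟩
        + 2 * powℤ (2 ℕ.+ t) + + 3 * (1ℤ + P) + -1^ (2 ℕ.+ t) * (H + H)
          ∎
        where
        open ≡-Reasoning
        κℤ[2+t]≡ : κℤ (2 ℕ.+ t) ≡ κℤ t + powℤ t * H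
        κℤ[2+t]≡ = trans (pos-+ (κ (suc t)) (p ℕ.^ t ℕ.* h)) (cong (λ z → κℤ t + z) (pos-* (p ℕ.^ t) h))
        powℤ[2+t]≡ : P * (P * powℤ t) ≡ powℤ (2 ℕ.+ t)
        powℤ[2+t]≡ = sym (trans (pos-* p (p ℕ.* p ℕ.^ t)) (trans (cong (+ p *_) (pos-* p (p ℕ.^ t)))
                    (cong (λ z → z * (z * powℤ t)) +p≡1+2h)))
        split : ∀ k x H → + 2 * (1ℤ + (1ℤ + (H + H))) * ((k + x * H) + (k + x * H))
                        ≡ + 2 * (1ℤ + (1ℤ + (H + H))) * (k + k) + + 4 * (1ℤ + (1ℤ + (H + H))) * x * H
        split k x H = solve (k ∷ x ∷ H ∷ [])
        merge : ∀ x s H → + 2 * x + + 3 * (1ℤ + (1ℤ + (H + H))) + s * (H + H) + + 4 * (1ℤ + (1ℤ + (H + H))) * x * H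
                        ≡ + 2 * ((1ℤ + (H + H)) * ((1ℤ + (H + H)) * x)) + + 3 * (1ℤ + (1ℤ + (H + H))) + s * (H + H)
        merge x s H = solve (x ∷ s ∷ H ∷ [])

    κ-closed-form : ∀ t → + 2 * (1ℤ + + p) * + (κ (suc t) ℕ.+ κ (suc t))
                          ≡ + 2 * + (p ℕ.^ t) + + 3 * (1ℤ + + p) + -1ℤ ^ t * + (p ℕ.∸ 1)
    κ-closed-form t = begin
      + 2 * (1ℤ + + p) * + (κ (suc t) ℕ.+ κ (suc t))  ≡⟨ cong₂ (λ q k → + 2 * (1ℤ + q) * k) +p≡1+2h (pos-+ (κ (suc t)) (κ (suc t))) ⟩
      + 2 * (1ℤ + P) * (κℤ t + κℤ t)                    ≡⟨ κ-closed-form′ t ⟩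
      + 2 * powℤ t + + 3 * (1ℤ + P) + -1^ t * (H + H)    ≡⟨ cong₂ (λ q d → + 2 * powℤ t + + 3 * (1ℤ + q) + -1^ t * d) (sym +p≡1+2h) (sym +[p∸1]≡2h) ⟩
      + 2 * + (p ℕ.^ t) + + 3 * (1ℤ + + p) + -1ℤ ^ t * + (p ℕ.∸ 1) ∎
      where
      open ≡-Reasoning
      +[p∸1]≡2h : + (p ℕ.∸ 1) ≡ H + H
      +[p∸1]≡2h = trans (cong (λ q → + (q ℕ.∸ 1)) p≡2h+1) (pos-+ h h)

    module ResidueCount (t : ℕ) {a : ℤ} (p∤a : ¬ + p ∣ a) (sq[a] : SquareMod p a) where

      N : ℕ
      N = p ℕ.^ suc t

      instance
        N-nonZero : ℕ.NonZero N
        N-nonZero = ℕP.m^n≢0 p (suc t)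

      b : ℕ
      b = proj₁ (SquareMod-residue (SquareMod-lift pp p≢2 p∤a sq[a] t))

      b²≈a : + b * + b ≈ a [ N ]
      b²≈a = proj₂ (proj₂ (SquareMod-residue (SquareMod-lift pp p≢2 p∤a sq[a] t)))

      p∣N : + p ∣ + N
      p∣N = ∣ᵤ⇒∣ (ℕD.m∣m*n (p ℕ.^ t))

      InS₂'' : ℕ → Set
      InS₂'' k = SquareMod N (+ k * + k - a) × + p ∣ + k * + k - a

      inS₂''? : Decidable InS₂''
      inS₂''? k = squareMod? N (+ k * + k - a) ×-dec (+ p ∣? + k * + k - a)

      e₀ : ℤ
      e₀ = + 2 * + b

      p∤e₀ : ¬ + p ∣ e₀
      p∤e₀ = ∤*∤⇒∤* pp (odd-prime∤2 pp p≢2) (λ (p∣b : + p ∣ + b) → p∤a (∣-resp-≈ (≈-weaken p∣N b²≈a) (∣m⇒∣m*n (+ b) p∣b)))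

      p∤-e₀ : ¬ + p ∣ - e₀
      p∤-e₀ p∣-e₀ = p∤e₀ (∣m⇒∣-m p∣-e₀ ∣-by neg-involutive e₀)

      module M₀ = Multiples p∤e₀
      module M₁ = Multiples p∤-e₀

      private
        respects : ∀ {j k} → + j ≈ + k [ N ] → + j * + j - a ≈ + k * + k - a [ N ]
        respects j≈k = ≈-+ʳ (- a) (≈-* j≈k j≈k)

        inS₂''-respectsMod : RespectsMod N InS₂''
        inS₂''-respectsMod j≈k (sq , p∣) = SquareMod-resp-≈ (respects j≈k) sq , ∣-resp-≈ (≈-weaken p∣N (respects j≈k)) p∣

      Shifted : ℕ → Set
      Shifted j = SquareMod N (M₀.quadratic 1ℤ j) × + p ∣ M₀.quadratic 1ℤ j

      shifted? : Decidable Shifted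
      shifted? j = squareMod? N (M₀.quadratic 1ℤ j) ×-dec (+ p ∣? M₀.quadratic 1ℤ j)

      root[b+j]≈ : ∀ j → + (b ℕ.+ j) * + (b ℕ.+ j) - a ≈ M₀.quadratic 1ℤ j [ N ]
      root[b+j]≈ j = begin
        + (b ℕ.+ j) * + (b ℕ.+ j) - a     ≡⟨ cong (λ z → z * z - a) (pos-+ b j) ⟩
        (+ b + + j) * (+ b + + j) - a     ≡⟨ expand (+ b) (+ j) a ⟩
        M₀.quadratic 1ℤ j + (+ b * + b - a) ≈⟨ ≈-+ˡ (M₀.quadratic 1ℤ j) (mk≈ (un≈ b²≈a ∣-by sym (+-identityʳ _))) ⟩
        M₀.quadratic 1ℤ j + 0ℤ            ≡⟨ +-identityʳ _ ⟩
        M₀.quadratic 1ℤ j                 ∎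
        where
        open ≈-Reasoning N
        expand : ∀ b j a → (b + j) * (b + j) - a ≡ j * (1ℤ * j + + 2 * b) + (b * b - a)
        expand b j a = solve (b ∷ j ∷ a ∷ [])

      count-S₂''≡shifted : count inS₂''? N ≡ count shifted? N
      count-S₂''≡shifted = begin
        count inS₂''? N                     ≡⟨ count-shift inS₂''? N (respectsMod⇒periodic inS₂''-respectsMod) b ⟨
        count (λ j → inS₂''? (b ℕ.+ j)) N   ≡⟨ count-cong _ shifted? N
                                               (λ j _ (sq , p∣) → SquareMod-resp-≈ (root[b+j]≈ j) sq , ∣-resp-≈ (≈-weaken p∣N (root[b+j]≈ j)) p∣)
                                               (λ j _ (sq , p∣) → SquareMod-resp-≈ (≈-sym (root[b+j]≈ j)) sq , ∣-resp-≈ (≈-weaken p∣N (≈-sym (root[b+j]≈ j))) p∣) ⟩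
        count shifted? N                  ∎
        where open ≡-Reasoning

      count-p∣shifted : count (λ j → (+ p ∣? + j) ×-dec shifted? j) N ≡ M₀.countMultiples 1ℤ (suc t)
      count-p∣shifted = count-cong _ _ N (λ _ _ (p∣j , sq , _) → p∣j , sq)
                                         (λ j _ (p∣j , sq) → p∣j , sq , ∣m⇒∣m*n (1ℤ * + j + e₀) p∣j)

      -- With c₀ ≡ −2b, the shift j = c₀ + i moves the multiples of p among the j + 2b to the multiples of p among the i.
      c₀ : ℕ
      c₀ = residue N (- e₀)

      c₀+i≈ : ∀ i → + (c₀ ℕ.+ i) ≈ + i - e₀ [ N ]
      c₀+i≈ i = ≈-trans (≈-reflexive (pos-+ c₀ i)) (≈-trans (≈-+ʳ (+ i) (residue-≈ N (- e₀))) (≈-reflexive (+-comm (- e₀) (+ i))))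

      linear≈ : ∀ i → 1ℤ * + (c₀ ℕ.+ i) + e₀ ≈ + i [ N ]
      linear≈ i = ≈-trans (≈-+ʳ e₀ (≈-*ˡ 1ℤ (c₀+i≈ i))) (≈-reflexive (cancel (+ i) e₀))
        where
        cancel : ∀ i e → 1ℤ * (i - e) + e ≡ i
        cancel i e = solve (i ∷ e ∷ [])

      quadratic-c₀+i≈ : ∀ i → M₀.quadratic 1ℤ (c₀ ℕ.+ i) ≈ M₁.quadratic 1ℤ i [ N ]
      quadratic-c₀+i≈ i = ≈-trans (≈-* (c₀+i≈ i) (linear≈ i)) (≈-reflexive (swap (+ i) e₀))
        where
        swap : ∀ i e → (i - e) * i ≡ i * (1ℤ * i + - e)
        swap i e = solve (i ∷ e ∷ [])

      count-p∤shifted : count (λ j → ¬? (+ p ∣? + j) ×-dec shifted? j) N ≡ M₁.countMultiples 1ℤ (suc t)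
      count-p∤shifted = begin
        count (λ j → ¬? (+ p ∣? + j) ×-dec shifted? j) N            ≡⟨ count-shift _ N (respectsMod⇒periodic respects-p∤shifted) c₀ ⟨
        count (λ i → ¬? (+ p ∣? + (c₀ ℕ.+ i)) ×-dec shifted? (c₀ ℕ.+ i)) N
          ≡⟨ count-cong _ _ N to from ⟩
        M₁.countMultiples 1ℤ (suc t)                                ∎
        where
        open ≡-Reasoning
        respects-p∤shifted : RespectsMod N (λ j → ¬ + p ∣ + j × Shifted j)
        respects-p∤shifted {j} {k} j≈k (p∤j , sq , p∣) =
          ∤-resp-≈ (≈-weaken p∣N j≈k) p∤j , SquareMod-resp-≈ quadratic≈ sq , ∣-resp-≈ (≈-weaken p∣N quadratic≈) p∣
          where
          quadratic≈ : M₀.quadratic 1ℤ j ≈ M₀.quadratic 1ℤ k [ N ]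
          quadratic≈ = ≈-* j≈k (≈-+ʳ e₀ (≈-*ˡ 1ℤ j≈k))
        to : ∀ i → i ℕ.< N → ¬ + p ∣ + (c₀ ℕ.+ i) × Shifted (c₀ ℕ.+ i) → + p ∣ + i × M₁.SquareAt (suc t) 1ℤ i
        to i _ (p∤j , sq , p∣) =
          Sum.[ (λ p∣j → ⊥-elim (p∤j p∣j)) , (λ p∣j+e₀ → ∣-resp-≈ (≈-weaken p∣N (linear≈ i)) p∣j+e₀) ]′ (∣*⇒∣⊎∣ pp _ _ p∣) ,
          SquareMod-resp-≈ (quadratic-c₀+i≈ i) sq
        from : ∀ i → i ℕ.< N → + p ∣ + i × M₁.SquareAt (suc t) 1ℤ i → ¬ + p ∣ + (c₀ ℕ.+ i) × Shifted (c₀ ℕ.+ i)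
        from i _ (p∣i , sq) = p∤j , SquareMod-resp-≈ (≈-sym (quadratic-c₀+i≈ i)) sq ,
                              ∣-resp-≈ (≈-weaken p∣N (≈-sym (quadratic-c₀+i≈ i))) (∣m⇒∣m*n _ p∣i)
          where
          p∤j : ¬ + p ∣ + (c₀ ℕ.+ i)
          p∤j p∣j = p∤e₀ (∣m∣n⇒∣m-n (∣-resp-≈ (≈-weaken p∣N (≈-sym (linear≈ i))) p∣i) (∣n⇒∣m*n 1ℤ p∣j)
                           ∣-by cancel (+ (c₀ ℕ.+ i)) e₀)
            where
            cancel : ∀ x e → (1ℤ * x + e) - 1ℤ * x ≡ e
            cancel x e = solve (x ∷ e ∷ [])

      count-S₂'' : count inS₂''? N ≡ κ (suc t) ℕ.+ κ (suc t)
      count-S₂'' = begin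
        count inS₂''? N
          ≡⟨ count-S₂''≡shifted ⟩
        count shifted? N
          ≡⟨ count-split (λ j → + p ∣? + j) shifted? N ⟩
        count (λ j → (+ p ∣? + j) ×-dec shifted? j) N ℕ.+ count (λ j → ¬? (+ p ∣? + j) ×-dec shifted? j) N
          ≡⟨ cong₂ ℕ._+_ count-p∣shifted count-p∤shifted ⟩
        M₀.countMultiples 1ℤ (suc t) ℕ.+ M₁.countMultiples 1ℤ (suc t)
          ≡⟨ cong₂ ℕ._+_ (M₀.countMultiples≡κ (suc t) 1ℤ) (M₁.countMultiples≡κ (suc t) 1ℤ) ⟩
        κ (suc t) ℕ.+ κ (suc t)
          ∎
        where open ≡-Reasoning

      hasSize-S₂'' : HasSize N (S₂'' a p N) (κ (suc t) ℕ.+ κ (suc t))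
      hasSize-S₂'' = subst (HasSize N (S₂'' a p N)) count-S₂'' (hasSize-cong
        (λ k _ ((x , mk≈ p^∣) , p∣) → (x , ∣⇒∣ᵤ p^∣) , ∣⇒∣ᵤ p∣)
        (λ k _ ((x , p^∣) , p∣) → (x , mk≈ (∣ᵤ⇒∣ p^∣)) , ∣ᵤ⇒∣ p∣)
        (hasSize-count inS₂''? N))

    p^-odd : ∀ k → ∃ λ m → p ℕ.^ k ≡ suc (m ℕ.+ m)
    p^-odd zero    = 0 , refl
    p^-odd (suc k) = let (m , p^k≡) = p^-odd k in
      m ℕ.+ h ℕ.* suc (m ℕ.+ m) , trans (cong₂ ℕ._*_ p≡2h+1 p^k≡) (odd*odd h m)
      where
      odd*odd : ∀ h m → suc (h ℕ.+ h) ℕ.* suc (m ℕ.+ m) ≡ suc ((m ℕ.+ h ℕ.* suc (m ℕ.+ m)) ℕ.+ (m ℕ.+ h ℕ.* suc (m ℕ.+ m)))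
      odd*odd = ℕ-solve-∀

    module NonResidueCount (t : ℕ) {a : ℤ} (¬sq[a] : ¬ SquareMod p a) where
      open Discriminant ¬sq[a]

      N : ℕ
      N = p ℕ.^ suc t

      instance
        N-nonZero : ℕ.NonZero N
        N-nonZero = ℕP.m^n≢0 p (suc t)

      p∣N : + p ∣ + N
      p∣N = ∣ᵤ⇒∣ (ℕD.m∣m*n (p ℕ.^ t))

      halfN : ℤ
      halfN = + suc (proj₁ (p^-odd (suc t)))

      2*halfN≈1 : + 2 * halfN ≈ 1ℤ [ N ]
      2*halfN≈1 = subst (+ 2 * halfN ≈ 1ℤ [_]) (sym (proj₂ (p^-odd (suc t)))) (2*[1+m]≈1 _)

      sumProduct⇒discriminantSquare : ∀ s → S̄₂ a N s → SquareMod N (+ s * + s - D)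
      sumProduct⇒discriminantSquare s (x , y , _ , _ , xy≡a , x+y≡s) = + x - + y , (begin
        (+ x - + y) * (+ x - + y)                        ≡⟨ difference (+ x) (+ y) ⟩
        (+ x + + y) * (+ x + + y) - + 4 * (+ x * + y)    ≈⟨ ≈-+ (≈-* x+y≈s x+y≈s) (≈-neg (≈-*ˡ (+ 4) xy≈a)) ⟩
        + s * + s - D                                    ∎)
        where
        open ≈-Reasoning N
        xy≈a : + x * + y ≈ a [ N ]
        xy≈a = mk≈ (∣ᵤ⇒∣ xy≡a)
        x+y≈s : + x + + y ≈ + s [ N ]
        x+y≈s = mk≈ (∣ᵤ⇒∣ x+y≡s)
        difference : ∀ x y → (x - y) * (x - y) ≡ (x + y) * (x + y) - + 4 * (x * y)
        difference x y = solve (x ∷ y ∷ [])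

      private
        halves-product : ∀ S u → u * u ≈ S * S - D [ N ] → (S + u) * halfN * ((S - u) * halfN) ≈ a [ N ]
        halves-product S u uu≈ = begin
          (S + u) * halfN * ((S - u) * halfN)       ≡⟨ product S u halfN ⟩
          (S * S - u * u) * (halfN * halfN)         ≈⟨ ≈-*ʳ (halfN * halfN) (≈-+ˡ (S * S) (≈-neg uu≈)) ⟩
          (S * S - (S * S - D)) * (halfN * halfN)   ≡⟨ cancel S D halfN ⟩
          D * (halfN * halfN)                       ≡⟨ quarter a halfN ⟩
          (+ 2 * halfN) * (+ 2 * halfN) * a         ≈⟨ ≈-*ʳ a (≈-* 2*halfN≈1 2*halfN≈1) ⟩
          1ℤ * 1ℤ * a                               ≡⟨ *-identityˡ a ⟩
          a                                         ∎
          where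
          open ≈-Reasoning N
          product : ∀ s u i → (s + u) * i * ((s - u) * i) ≡ (s * s - u * u) * (i * i)
          product s u i = solve (s ∷ u ∷ i ∷ [])
          cancel : ∀ s D i → (s * s - (s * s - D)) * (i * i) ≡ D * (i * i)
          cancel s D i = solve (s ∷ D ∷ i ∷ [])
          quarter : ∀ a i → + 4 * a * (i * i) ≡ (+ 2 * i) * (+ 2 * i) * a
          quarter a i = solve (a ∷ i ∷ [])

        halves-sum : ∀ S u → (S + u) * halfN + (S - u) * halfN ≈ S [ N ]
        halves-sum S u = begin
          (S + u) * halfN + (S - u) * halfN   ≡⟨ sum S u halfN ⟩
          S * (+ 2 * halfN)                   ≈⟨ ≈-*ˡ S 2*halfN≈1 ⟩
          S * 1ℤ                              ≡⟨ *-identityʳ S ⟩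
          S                                   ∎
          where
          open ≈-Reasoning N
          sum : ∀ s u i → (s + u) * i + (s - u) * i ≡ s * (+ 2 * i)
          sum s u i = solve (s ∷ u ∷ i ∷ [])

        factors-positive : ∀ {x y} → + x * + y ≈ a [ N ] → 1 ℕ.≤ x × 1 ℕ.≤ y
        factors-positive {x} {y} xy≈a = ℕP.n≢0⇒n>0 x≢0 , ℕP.n≢0⇒n>0 y≢0
          where
          p∤xy : ¬ + p ∣ + x * + y
          p∤xy p∣xy = p∤a (∣-resp-≈ (≈-weaken p∣N xy≈a) p∣xy)
          x≢0 : x ≢ 0
          x≢0 x≡0 = p∤xy (subst (λ z → + p ∣ + z * + y) (sym x≡0) ∣0)
          y≢0 : y ≢ 0
          y≢0 y≡0 = p∤xy (subst (λ z → + p ∣ + x * + z) (sym y≡0) (∣0 ∣-by sym (*-zeroʳ (+ x))))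

      discriminantSquare⇒sumProduct : ∀ s → SquareMod N (+ s * + s - D) → S̄₂ a N s
      discriminantSquare⇒sumProduct s (u , uu≈) =
        x , y , (proj₁ (factors-positive {x} xy≈a) , residue-< N X) , (proj₂ (factors-positive {x} xy≈a) , residue-< N Y) ,
        ∣⇒∣ᵤ (un≈ xy≈a) , ∣⇒∣ᵤ (un≈ x+y≈s)
        where
        X Y : ℤ
        X = (+ s + u) * halfN
        Y = (+ s - u) * halfN
        x y : ℕ
        x = residue N X
        y = residue N Y
        xy≈a : + x * + y ≈ a [ N ]
        xy≈a = ≈-trans (≈-* (residue-≈ N X) (residue-≈ N Y)) (halves-product (+ s) u uu≈)
        x+y≈s : + x + + y ≈ + s [ N ]
        x+y≈s = ≈-trans (≈-+ (residue-≈ N X) (residue-≈ N Y)) (halves-sum (+ s) u)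

      discriminantSquareMod? : Decidable (λ s → SquareMod N (+ s * + s - D))
      discriminantSquareMod? s = squareMod? N (+ s * + s - D)

      count-discriminantSquareMod : count discriminantSquareMod? N ≡ p ℕ.^ t ℕ.* h
      count-discriminantSquareMod = begin
        count discriminantSquareMod? N
          ≡⟨ count-cong _ discriminantSquare? N (λ _ _ → SquareMod-weaken p∣N)
               (λ s _ sq → SquareMod-lift pp p≢2 (λ p∣ → ¬sq[D] (+ s , mk≈ p∣)) sq t) ⟩
        count discriminantSquare? (p ℕ.* p ℕ.^ t)
          ≡⟨ cong (count discriminantSquare?) (ℕP.*-comm p (p ℕ.^ t)) ⟩
        count discriminantSquare? (p ℕ.^ t ℕ.* p)
          ≡⟨ count-periodic discriminantSquare? p (p ℕ.^ t) (respectsMod⇒periodic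
               (λ j≈k → SquareMod-resp-≈ (≈-+ʳ (- D) (≈-* j≈k j≈k)))) ⟩
        p ℕ.^ t ℕ.* count discriminantSquare? p
          ≡⟨ cong (p ℕ.^ t ℕ.*_) count-discriminantSquare ⟩
        p ℕ.^ t ℕ.* h
          ∎
        where open ≡-Reasoning

      S₂''-empty : HasSize N (S₂'' a p N) 0
      S₂''-empty = [] , [] , refl , λ k → mk⇔ (λ ()) (λ (_ , _ , p∣) → ⊥-elim (¬sq[a] (+ k , mk≈ (∣ᵤ⇒∣ p∣))))

      hasSize-S̄₂ : HasSize N (S̄₂ a N) (p ℕ.^ t ℕ.* h)
      hasSize-S̄₂ = subst (HasSize N (S̄₂ a N)) count-discriminantSquareMod (hasSize-cong
        (λ s _ → discriminantSquare⇒sumProduct s) (λ s _ → sumProduct⇒discriminantSquare s)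
        (hasSize-count discriminantSquareMod? N))

      φ[N]≡2*size : φ N ≡ p ℕ.^ t ℕ.* h ℕ.* 2
      φ[N]≡2*size = begin
        φ N                         ≡⟨ φ-p^ pp t ⟩
        p ℕ.^ t ℕ.* (p ℕ.∸ 1)       ≡⟨ cong (λ q → p ℕ.^ t ℕ.* (q ℕ.∸ 1)) p≡2h+1 ⟩
        p ℕ.^ t ℕ.* (h ℕ.+ h)       ≡⟨ double (p ℕ.^ t) h ⟩
        p ℕ.^ t ℕ.* h ℕ.* 2         ∎
        where
        open ≡-Reasoning
        double : ∀ x h → x ℕ.* (h ℕ.+ h) ≡ x ℕ.* h ℕ.* 2
        double = ℕ-solve-∀

open import Defs
open import Data.Nat.Base using (ℕ; suc; _≤_; _^_; _∸_; _*_)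
open import Data.Nat.Primality using (Prime)
open import Data.Integer.Base using (ℤ; +_; -[1+_]) renaming (_^_ to _^ℤ_; _*_ to _*ℤ_)
open import Data.Integer.Divisibility using () renaming (_∣_ to _∣ℤ_)
open import Data.Rational.Base using (ℚ; _/_) renaming (_+_ to _+ℚ_)
open import Data.Product.Base using (_×_; ∃)
open import Relation.Nullary.Negation.Core using (¬_)
open import Relation.Binary.PropositionalEquality using (_≡_)

open import Data.Nat.Base using (_+_)
open import Data.Integer.Divisibility.Signed using (∣⇒∣ᵤ) renaming (_∣_ to _∣ₛ_)
open import Data.Product.Base using (_,_; proj₁; proj₂)
open import Relation.Binary.PropositionalEquality using (sym)
open QuadraticResidues
  using (module OddPrime; odd-prime⇒≡2h+1; legendre≡1⇒square; legendre≡-1⇒nonsquare;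
         m*2≡n⇒m/1≡n/2; m/1≡A/[1+d]+3/2+B/[2*[1+d]])

lemma3p5 : (p t : ℕ) (a : ℤ) → Prime p → ¬ (2 ≡ p) → 1 ≤ t → ¬ ((+ p) ∣ℤ a) →
    ((legendre a p ≡ -[1+ 0 ]) →
      HasSize (p ^ t) (S₂'' a p (p ^ t)) 0 ×
      (∃ λ m → HasSize (p ^ t) (S̄₂ a (p ^ t)) m × ((+ m) / 1 ≡ (+ φ (p ^ t)) / 2))) ×
    ((legendre a p ≡ + 1) →
      ∃ λ m → HasSize (p ^ t) (S₂'' a p (p ^ t)) m ×
        ((+ m) / 1 ≡ ((+ (p ^ (t ∸ 1))) / suc p
                       +ℚ (+ 3) / 2
                       +ℚ ((-[1+ 0 ] ^ℤ (t ∸ 1)) *ℤ (+ (p ∸ 1))) / (2 * suc p))))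
lemma3p5 p (suc t) a pp 2≢p _ p∤a =
  (λ leg → let open NonResidueCount t (legendre≡-1⇒nonsquare leg) in
    S₂''-empty , p ^ t * h , hasSize-S̄₂ , m*2≡n⇒m/1≡n/2 (p ^ t * h) (φ (p ^ suc t)) (sym φ[N]≡2*size)) ,
  (λ leg → let open ResidueCount t p∤a′ (legendre≡1⇒square leg) in
    κ (suc t) + κ (suc t) , hasSize-S₂'' ,
    m/1≡A/[1+d]+3/2+B/[2*[1+d]] (κ (suc t) + κ (suc t)) p (+ (p ^ t)) (-[1+ 0 ] ^ℤ t *ℤ + (p ∸ 1)) (κ-closed-form t))
  where
  h : ℕ
  h = proj₁ (odd-prime⇒≡2h+1 pp 2≢p)
  open OddPrime {h = h} pp (proj₂ (odd-prime⇒≡2h+1 pp 2≢p))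
  p∤a′ : ¬ (+ p) ∣ₛ a
  p∤a′ p∣a = p∤a (∣⇒∣ᵤ p∣a)
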